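{- Let $G$ be a dag on $n$ vertices, let $t_1,t_2>0$, and let $G_d$ be the associated weighted digraph. Then the minimum mean weight of a cycle of $G_d$ equals $$\min_{\{(i,v)\,:\, l(i,v)=n\}}\ \max_{0\le j<i}\ \frac{H(i,v)-H(j,v)}{n-l(j,v)}.$$
   Context: Given a dag $G=(V,E)$ and $t_1,t_2>0$, $G_d$ is the weighted digraph on vertex set $V$ having an edge $(y,x)$ of weight $-t_1$ for each edge $(x,y)\in E$, and edges $(u,v)$ and $(v,u)$ of weight $t_2$ for each pair $\{u,v\}$ of distinct vertices such that neither $(u,v)$ nor $(v,u)$ is in $E$. The length of a walk is its number of edge occurrences and its weight is the sum of the weights of its edge occurrences; the mean weight of a cycle is its weight divided by its length. For $i\ge 0$ and $v\in V$, $H(i,v)$ is the minimum weight of a walk in $G_d$ (starting at any vertex) ending at $v$ that contains exactly $i$ occurrences of edges of weight $t_2$ (walks of length $0$ allowed), and $l(i,v)$ is the length of such a minimum-weight walk, namely $l(i,v)=i+(it_2-H(i,v))/t_1$.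
   Formalization: The parameters t₁ and t₂ range over the positive rationals. -}

module Defs where

open import Data.Nat as ℕ using (ℕ; zero; suc)
open import Data.Fin using (Fin)
open import Data.Bool using (Bool; true; false)
open import Data.Integer using (+_)
open import Data.List using (List; []; _∷_)
open import Data.List.Relation.Unary.Unique.Propositional using (Unique)
open import Data.Product using (Σ; Σ-syntax; _×_; _,_)
open import Data.Rational as ℚ using (ℚ; 0ℚ; _+_; _*_; _-_; _≤_; _<_; -_)
open import Relation.Binary.PropositionalEquality using (_≡_; _≢_)
open import Relation.Nullary using (¬_; yes; no)

ℕ→ℚ : ℕ → ℚ
ℕ→ℚ k = (+ k) ℚ./ 1

-- total division on ℚ (convention p / 0 = 0; in the theorem every
-- denominator that occurs is positive, so the convention is never used)
_/ₜ_ : ℚ → ℚ → ℚ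
p /ₜ q with q ℚ.≟ 0ℚ
... | yes _  = 0ℚ
... | no q≢0 = ℚ._÷_ p q {{ℚ.≢-nonZero q≢0}}

-- A digraph G on the vertex set Fin n is given by its (decidable)
-- adjacency relation E : (x,y) ∈ E  iff  E x y ≡ true.

data EWalk {n : ℕ} (E : Fin n → Fin n → Bool) : ℕ → Fin n → Fin n → Set where
  []  : ∀ {x} → EWalk E 0 x x
  _∷_ : ∀ {k x y z} → E x y ≡ true → EWalk E k y z → EWalk E (suc k) x z

IsDag : {n : ℕ} → (Fin n → Fin n → Bool) → Set
IsDag {n} E = ∀ {k : ℕ} {x : Fin n} → ¬ EWalk E (suc k) x x

data DEdge {n : ℕ} (E : Fin n → Fin n → Bool) : Fin n → Fin n → Set where
  -- for each edge (x,y) ∈ E an edge (y,x) of weight -t₁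
  rev : ∀ {x y} → E x y ≡ true → DEdge E y x
  -- for distinct non-adjacent u,v, edges (u,v) (and (v,u)) of weight t₂
  non : ∀ {u v} → u ≢ v → E u v ≡ false → E v u ≡ false → DEdge E u v

edgeWeight : ∀ {n} {E : Fin n → Fin n → Bool} {u v} → (t₁ t₂ : ℚ) → DEdge E u v → ℚ
edgeWeight t₁ t₂ (rev _)     = - t₁
edgeWeight t₁ t₂ (non _ _ _) = t₂

isT₂ : ∀ {n} {E : Fin n → Fin n → Bool} {u v} → DEdge E u v → ℕ
isT₂ (rev _)     = 0
isT₂ (non _ _ _) = 1

data DWalk {n : ℕ} (E : Fin n → Fin n → Bool) : Fin n → Fin n → Set where
  []  : ∀ {x} → DWalk E x x
  _∷_ : ∀ {x y z} → DEdge E x y → DWalk E y z → DWalk E x z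

module _ {n : ℕ} {E : Fin n → Fin n → Bool} where

  len : ∀ {x y} → DWalk E x y → ℕ
  len []       = 0
  len (_ ∷ w)  = suc (len w)

  weight : (t₁ t₂ : ℚ) → ∀ {x y} → DWalk E x y → ℚ
  weight t₁ t₂ []      = 0ℚ
  weight t₁ t₂ (e ∷ w) = edgeWeight t₁ t₂ e + weight t₁ t₂ w

  #t₂ : ∀ {x y} → DWalk E x y → ℕ
  #t₂ []      = 0
  #t₂ (e ∷ w) = isT₂ e ℕ.+ #t₂ w

  starts : ∀ {x y} → DWalk E x y → List (Fin n)
  starts []            = []
  starts (_∷_ {x} e w) = x ∷ starts w

  IsCycle : ∀ {x} → DWalk E x x → Set
  IsCycle w = (1 ℕ.≤ len w) × Unique (starts w)

  meanWeight : (t₁ t₂ : ℚ) → ∀ {x y} → DWalk E x y → ℚ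
  meanWeight t₁ t₂ w = weight t₁ t₂ w /ₜ ℕ→ℚ (len w)

IsMinMeanCycleWeight : ∀ {n} → (Fin n → Fin n → Bool) → (t₁ t₂ μ : ℚ) → Set
IsMinMeanCycleWeight {n} E t₁ t₂ μ =
  (Σ[ x ∈ Fin n ] Σ[ w ∈ DWalk E x x ] IsCycle w × meanWeight t₁ t₂ w ≡ μ)
  × (∀ (x : Fin n) (w : DWalk E x x) → IsCycle w → μ ≤ meanWeight t₁ t₂ w)

IsH : ∀ {n} → (Fin n → Fin n → Bool) → (t₁ t₂ : ℚ) → ℕ → Fin n → ℚ → Set
IsH {n} E t₁ t₂ i v h =
  (Σ[ x ∈ Fin n ] Σ[ w ∈ DWalk E x v ] #t₂ w ≡ i × weight t₁ t₂ w ≡ h)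
  × (∀ (x : Fin n) (w : DWalk E x v) → #t₂ w ≡ i → h ≤ weight t₁ t₂ w)

lval : (t₁ t₂ : ℚ) → ℕ → ℚ → ℚ
lval t₁ t₂ i h = ℕ→ℚ i + ((ℕ→ℚ i * t₂ - h) /ₜ t₁)

IsMaxRatio : ∀ {n} → (Fin n → Fin n → Bool) → (t₁ t₂ : ℚ) → ℕ → Fin n → ℚ → ℚ → Set
IsMaxRatio {n} E t₁ t₂ i v h m =
  (Σ[ j ∈ ℕ ] Σ[ hj ∈ ℚ ] j ℕ.< i × IsH E t₁ t₂ j v hj
      × (h - hj) /ₜ (ℕ→ℚ n - lval t₁ t₂ j hj) ≡ m)
  × (∀ (j : ℕ) (hj : ℚ) → j ℕ.< i → IsH E t₁ t₂ j v hj
      → (h - hj) /ₜ (ℕ→ℚ n - lval t₁ t₂ j hj) ≤ m)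

IsMinMaxRatio : ∀ {n} → (Fin n → Fin n → Bool) → (t₁ t₂ μ : ℚ) → Set
IsMinMaxRatio {n} E t₁ t₂ μ =
  (Σ[ i ∈ ℕ ] Σ[ v ∈ Fin n ] Σ[ h ∈ ℚ ]
      IsH E t₁ t₂ i v h × lval t₁ t₂ i h ≡ ℕ→ℚ n × IsMaxRatio E t₁ t₂ i v h μ)
  × (∀ (i : ℕ) (v : Fin n) (h m : ℚ) → IsH E t₁ t₂ i v h → lval t₁ t₂ i h ≡ ℕ→ℚ n
      → IsMaxRatio E t₁ t₂ i v h m → μ ≤ m)

module Submission where

-- A walk of G_d is summarised by its profile (a , b): a edges of weight t₂ and b of weight
-- −t₁.  Its weight is wt a b = a·t₂ − b·t₁ and its length is a + b.  Since G is a dag, every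
-- closed walk contains a t₂-edge, which bounds b in terms of a and n; so H(i,v) = wt i R,
-- where R = R(i,v) is the largest b among walks ending at v with a = i, and l(i,v) = i + R.
-- A peeling argument shows that R(·,v) is monotone, so n − l(j,v) > 0 for j < i whenever
-- l(i,v) = n, and each quotient of the theorem is the mean weight of a difference profile.
--
-- Upper bound: if l(i,v) = n, an optimal walk for H(i,v) has n edges and contains a cycle C;
-- cutting C out yields j < i whose quotient is at least the mean weight of C.
-- Lower bound (Karp): let Cs be a closed walk of least mean weight μ and reweight walks by
-- φ ∝ weight − μ·length.  A φ-minimal walk to Cs followed by Cs repeated n times has a
-- prefix of length n that is φ-minimal; it yields an (i,v) with l(i,v) = n all of whose
-- quotients are at most μ, with equality at the cycle cut out of it.

open import Defs
open import Data.Nat as ℕ using (ℕ; zero; suc)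
import Data.Nat.Properties as ℕP
import Data.Integer as ℤ
import Data.Integer.Properties as ℤP
open import Data.Rational as ℚ using (ℚ; 0ℚ; 1ℚ)
import Data.Rational.Properties as ℚP
open import Data.Rational.Unnormalised as ℚᵘ using (mkℚᵘ; *≡*)
import Data.Rational.Unnormalised.Properties as ℚᵘP
open import Data.Rational.Solver using (module +-*-Solver)
open import Data.Product using (_,_)
open import Data.Fin as Fin using (Fin)
import Data.Fin.Properties as FinP
open import Data.Bool using (Bool; true; false)
open import Data.List.Relation.Unary.Unique.Propositional using (Unique)
open import Function.Bundles using (_⇔_; mk⇔; Equivalence)
open import Function.Properties.Equivalence using () renaming (trans to ⇔-trans)
open import Relation.Binary.PropositionalEquality
open import Relation.Nullary using (yes; no)
open import Data.Empty using (⊥-elim)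
open import Data.Nat.Tactic.RingSolver using (solve-∀)
open +-*-Solver

module RationalFacts where
  open import Data.Rational using (_+_; _*_; _-_; -_; _≤_; _<_; 1/_)

  toℚᵘ-ℕ→ℚ : ∀ k → ℚ.toℚᵘ (ℕ→ℚ k) ℚᵘ.≃ mkℚᵘ (ℤ.+ k) 0
  toℚᵘ-ℕ→ℚ k = ℚP.toℚᵘ-fromℚᵘ (mkℚᵘ (ℤ.+ k) 0)

  ℕ→ℚ-+ : ∀ a b → ℕ→ℚ (a ℕ.+ b) ≡ ℕ→ℚ a + ℕ→ℚ b
  ℕ→ℚ-+ a b = ℚP.toℚᵘ-injective (begin
    ℚ.toℚᵘ (ℕ→ℚ (a ℕ.+ b))               ≈⟨ toℚᵘ-ℕ→ℚ (a ℕ.+ b) ⟩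
    mkℚᵘ (ℤ.+ (a ℕ.+ b)) 0                ≈⟨ *≡* (cong (ℤ._* ℤ.+ 1) sum) ⟩
    mkℚᵘ (ℤ.+ a) 0 ℚᵘ.+ mkℚᵘ (ℤ.+ b) 0    ≈⟨ ℚᵘP.+-cong (toℚᵘ-ℕ→ℚ a) (toℚᵘ-ℕ→ℚ b) ⟨
    ℚ.toℚᵘ (ℕ→ℚ a) ℚᵘ.+ ℚ.toℚᵘ (ℕ→ℚ b)  ≈⟨ ℚP.toℚᵘ-homo-+ (ℕ→ℚ a) (ℕ→ℚ b) ⟨
    ℚ.toℚᵘ (ℕ→ℚ a + ℕ→ℚ b)               ∎)
    where
    open ℚᵘP.≃-Reasoning
    sum : ℤ.+ (a ℕ.+ b) ≡ (ℤ.+ a) ℤ.* (ℤ.+ 1) ℤ.+ (ℤ.+ b) ℤ.* (ℤ.+ 1)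
    sum = trans (ℤP.pos-+ a b) (sym (cong₂ ℤ._+_ (ℤP.*-identityʳ (ℤ.+ a)) (ℤP.*-identityʳ (ℤ.+ b))))

  ℕ→ℚ-* : ∀ a b → ℕ→ℚ (a ℕ.* b) ≡ ℕ→ℚ a * ℕ→ℚ b
  ℕ→ℚ-* a b = ℚP.toℚᵘ-injective (begin
    ℚ.toℚᵘ (ℕ→ℚ (a ℕ.* b))               ≈⟨ toℚᵘ-ℕ→ℚ (a ℕ.* b) ⟩
    mkℚᵘ (ℤ.+ (a ℕ.* b)) 0                ≈⟨ *≡* (cong (ℤ._* ℤ.+ 1) (ℤP.pos-* a b)) ⟩
    mkℚᵘ (ℤ.+ a) 0 ℚᵘ.* mkℚᵘ (ℤ.+ b) 0    ≈⟨ ℚᵘP.*-cong (toℚᵘ-ℕ→ℚ a) (toℚᵘ-ℕ→ℚ b) ⟨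
    ℚ.toℚᵘ (ℕ→ℚ a) ℚᵘ.* ℚ.toℚᵘ (ℕ→ℚ b)  ≈⟨ ℚP.toℚᵘ-homo-* (ℕ→ℚ a) (ℕ→ℚ b) ⟨
    ℚ.toℚᵘ (ℕ→ℚ a * ℕ→ℚ b)               ∎)
    where open ℚᵘP.≃-Reasoning

  ℕ→ℚ-nonNeg : ∀ k → 0ℚ ≤ ℕ→ℚ k
  ℕ→ℚ-nonNeg k = ℚP.nonNegative⁻¹ (ℕ→ℚ k) {{ℚP.normalize-nonNeg k 1}}

  ℕ→ℚ-pos : ∀ k → 0ℚ < ℕ→ℚ (suc k)
  ℕ→ℚ-pos k = ℚP.positive⁻¹ (ℕ→ℚ (suc k)) {{ℚP.normalize-pos (suc k) 1}}

  ℕ→ℚ-mono-≤ : ∀ {a b} → a ℕ.≤ b → ℕ→ℚ a ≤ ℕ→ℚ b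
  ℕ→ℚ-mono-≤ {a} {b} a≤b with ℕP.m≤n⇒∃[o]m+o≡n a≤b
  ... | d , refl = begin
    ℕ→ℚ a          ≡⟨ ℚP.+-identityʳ (ℕ→ℚ a) ⟨
    ℕ→ℚ a + 0ℚ     ≤⟨ ℚP.+-monoʳ-≤ (ℕ→ℚ a) (ℕ→ℚ-nonNeg d) ⟩
    ℕ→ℚ a + ℕ→ℚ d  ≡⟨ ℕ→ℚ-+ a d ⟨
    ℕ→ℚ (a ℕ.+ d)  ∎
    where open ℚP.≤-Reasoning

  ℕ→ℚ-mono-< : ∀ {a b} → a ℕ.< b → ℕ→ℚ a < ℕ→ℚ b
  ℕ→ℚ-mono-< {a} {b} a<b with ℕP.m≤n⇒∃[o]m+o≡n a<b
  ... | d , refl = begin-strict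
    ℕ→ℚ a                ≡⟨ ℚP.+-identityʳ (ℕ→ℚ a) ⟨
    ℕ→ℚ a + 0ℚ           <⟨ ℚP.+-monoʳ-< (ℕ→ℚ a) (ℕ→ℚ-pos d) ⟩
    ℕ→ℚ a + ℕ→ℚ (suc d)  ≡⟨ ℕ→ℚ-+ a (suc d) ⟨
    ℕ→ℚ (a ℕ.+ suc d)    ≡⟨ cong ℕ→ℚ (ℕP.+-suc a d) ⟩
    ℕ→ℚ (suc a ℕ.+ d)    ∎
    where open ℚP.≤-Reasoning

  ℕ→ℚ-cancel-≤ : ∀ {a b} → ℕ→ℚ a ≤ ℕ→ℚ b → a ℕ.≤ b
  ℕ→ℚ-cancel-≤ {a} {b} le with a ℕP.≤? b
  ... | yes a≤b = a≤b
  ... | no a≰b  = ⊥-elim (ℚP.<-irrefl refl (ℚP.<-≤-trans (ℕ→ℚ-mono-< (ℕP.≰⇒> a≰b)) le))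

  ℕ→ℚ-injective : ∀ {a b} → ℕ→ℚ a ≡ ℕ→ℚ b → a ≡ b
  ℕ→ℚ-injective eq = ℕP.≤-antisym (ℕ→ℚ-cancel-≤ (ℚP.≤-reflexive eq)) (ℕ→ℚ-cancel-≤ (ℚP.≤-reflexive (sym eq)))

  ℕ→ℚ-scaled-≤⇔ : ∀ {t} a b → 0ℚ < t → (ℕ→ℚ a * t ≤ ℕ→ℚ b * t) ⇔ (a ℕ.≤ b)
  ℕ→ℚ-scaled-≤⇔ {t} a b t>0 = mk⇔
    (λ le → ℕ→ℚ-cancel-≤ (ℚP.*-cancelʳ-≤-pos t {{ℚ.positive t>0}} le))
    (λ le → ℚP.*-monoʳ-≤-nonNeg t {{ℚP.pos⇒nonNeg t {{ℚ.positive t>0}}}} (ℕ→ℚ-mono-≤ le))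

  ℕ→ℚ-*-≤⇔ : ∀ a b c d → (ℕ→ℚ a * ℕ→ℚ b ≤ ℕ→ℚ c * ℕ→ℚ d) ⇔ (a ℕ.* b ℕ.≤ c ℕ.* d)
  ℕ→ℚ-*-≤⇔ a b c d = mk⇔
    (λ le → ℕ→ℚ-cancel-≤ (subst₂ _≤_ (sym (ℕ→ℚ-* a b)) (sym (ℕ→ℚ-* c d)) le))
    (λ le → subst₂ _≤_ (ℕ→ℚ-* a b) (ℕ→ℚ-* c d) (ℕ→ℚ-mono-≤ le))

  pos⇒≢0 : ∀ {q} → 0ℚ < q → q ≢ 0ℚ
  pos⇒≢0 q>0 refl = ℚP.<-irrefl refl q>0

  /ₜ-*-cancel : ∀ p q → q ≢ 0ℚ → (p /ₜ q) * q ≡ p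
  /ₜ-*-cancel p q q≢0 with q ℚ.≟ 0ℚ
  ... | yes q≡0  = ⊥-elim (q≢0 q≡0)
  ... | no q≢0′ = begin
    (p * 1/ q) * q  ≡⟨ ℚP.*-assoc p (1/ q) q ⟩
    p * (1/ q * q)  ≡⟨ cong (p *_) (ℚP.*-inverseˡ q) ⟩
    p * 1ℚ          ≡⟨ ℚP.*-identityʳ p ⟩
    p               ∎
    where open ≡-Reasoning
          instance _ = ℚ.≢-nonZero q≢0′

  *-/ₜ-cancel : ∀ p q → q ≢ 0ℚ → (p * q) /ₜ q ≡ p
  *-/ₜ-cancel p q q≢0 with q ℚ.≟ 0ℚ
  ... | yes q≡0  = ⊥-elim (q≢0 q≡0)
  ... | no q≢0′ = begin
    (p * q) * 1/ q  ≡⟨ ℚP.*-assoc p q (1/ q) ⟩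
    p * (q * 1/ q)  ≡⟨ cong (p *_) (ℚP.*-inverseʳ q) ⟩
    p * 1ℚ          ≡⟨ ℚP.*-identityʳ p ⟩
    p               ∎
    where open ≡-Reasoning
          instance _ = ℚ.≢-nonZero q≢0′

  /ₜ-≤⇔cross : ∀ x y d d′ → 0ℚ < d → 0ℚ < d′ → (x /ₜ d ≤ y /ₜ d′) ⇔ (x * d′ ≤ y * d)
  /ₜ-≤⇔cross x y d d′ d>0 d′>0 = mk⇔ to from
    where
    open ℚP.≤-Reasoning
    dd′>0 : 0ℚ < d * d′
    dd′>0 = ℚP.positive⁻¹ (d * d′) {{ℚP.pos*pos⇒pos d {{ℚ.positive d>0}} d′ {{ℚ.positive d′>0}}}}
    x≡ : x * d′ ≡ (x /ₜ d) * (d * d′)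
    x≡ = begin-equality
      x * d′                ≡⟨ cong (_* d′) (/ₜ-*-cancel x d (pos⇒≢0 d>0)) ⟨
      ((x /ₜ d) * d) * d′   ≡⟨ ℚP.*-assoc (x /ₜ d) d d′ ⟩
      (x /ₜ d) * (d * d′)   ∎
    y≡ : y * d ≡ (y /ₜ d′) * (d * d′)
    y≡ = begin-equality
      y * d                   ≡⟨ cong (_* d) (/ₜ-*-cancel y d′ (pos⇒≢0 d′>0)) ⟨
      ((y /ₜ d′) * d′) * d    ≡⟨ solve 3 (λ u a b → (u :* b) :* a := u :* (a :* b)) refl (y /ₜ d′) d d′ ⟩
      (y /ₜ d′) * (d * d′)    ∎
    to : x /ₜ d ≤ y /ₜ d′ → x * d′ ≤ y * d
    to le = begin
      x * d′               ≡⟨ x≡ ⟩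
      (x /ₜ d) * (d * d′)  ≤⟨ ℚP.*-monoʳ-≤-nonNeg (d * d′) {{ℚP.pos⇒nonNeg (d * d′) {{ℚ.positive dd′>0}}}} le ⟩
      (y /ₜ d′) * (d * d′) ≡⟨ y≡ ⟨
      y * d                ∎
    from : x * d′ ≤ y * d → x /ₜ d ≤ y /ₜ d′
    from le = ℚP.*-cancelʳ-≤-pos (d * d′) {{ℚ.positive dd′>0}} (subst₂ _≤_ x≡ y≡ le)

  +-cancelʳ-≤ : ∀ p q c → p + c ≤ q + c → p ≤ q
  +-cancelʳ-≤ p q c le = begin
    p              ≡⟨ solve 2 (λ x y → x := (x :+ y) :+ (:- y)) refl p c ⟩
    (p + c) + - c  ≤⟨ ℚP.+-monoˡ-≤ (- c) le ⟩
    (q + c) + - c  ≡⟨ solve 2 (λ x y → (x :+ y) :+ (:- y) := x) refl q c ⟩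
    q              ∎
    where open ℚP.≤-Reasoning

  +-≡⇒≤⇔ : ∀ p q c e → p + c ≡ q + e → (p ≤ q) ⇔ (e ≤ c)
  +-≡⇒≤⇔ p q c e eq = mk⇔ to from
    where
    open ℚP.≤-Reasoning
    to : p ≤ q → e ≤ c
    to p≤q = +-cancelʳ-≤ e c q (begin
      e + q  ≡⟨ ℚP.+-comm e q ⟩
      q + e  ≡⟨ eq ⟨
      p + c  ≤⟨ ℚP.+-monoˡ-≤ c p≤q ⟩
      q + c  ≡⟨ ℚP.+-comm q c ⟩
      c + q  ∎)
    from : e ≤ c → p ≤ q
    from e≤c = +-cancelʳ-≤ p q c (begin
      p + c  ≡⟨ eq ⟩
      q + e  ≤⟨ ℚP.+-monoʳ-≤ q e≤c ⟩
      q + c  ∎)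

open RationalFacts

-- Weights of walk profiles, for arbitrary t₁ t₂; this module is used both for the weights
-- of G_d and for Karp's reweighting.
module ProfileWeight (t₁ t₂ : ℚ) where
  open import Data.Rational using (_+_; _*_; _-_; -_; _≤_; _<_)

  wt : ℕ → ℕ → ℚ
  wt a b = ℕ→ℚ a * t₂ - ℕ→ℚ b * t₁

  mean : ℕ → ℕ → ℚ
  mean a b = wt a b /ₜ ℕ→ℚ (a ℕ.+ b)

  wt-zero : wt 0 0 ≡ 0ℚ
  wt-zero = solve 2 (λ T₁ T₂ → con 0ℚ :* T₂ :- con 0ℚ :* T₁ := con 0ℚ) refl t₁ t₂

  wt-+ : ∀ a b a′ b′ → wt (a ℕ.+ a′) (b ℕ.+ b′) ≡ wt a b + wt a′ b′
  wt-+ a b a′ b′ rewrite ℕ→ℚ-+ a a′ | ℕ→ℚ-+ b b′ =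
    solve 6 (λ A B A′ B′ T₁ T₂ → (A :+ A′) :* T₂ :- (B :+ B′) :* T₁
                                := (A :* T₂ :- B :* T₁) :+ (A′ :* T₂ :- B′ :* T₁))
      refl (ℕ→ℚ a) (ℕ→ℚ b) (ℕ→ℚ a′) (ℕ→ℚ b′) t₁ t₂

  wt-suc₂ : ∀ a b → t₂ + wt a b ≡ wt (suc a) b
  wt-suc₂ a b = begin
    t₂ + wt a b           ≡⟨ cong (_+ wt a b) t₂≡ ⟩
    wt 1 0 + wt a b       ≡⟨ wt-+ 1 0 a b ⟨
    wt (suc a) b          ∎
    where open ≡-Reasoning
          t₂≡ : t₂ ≡ wt 1 0
          t₂≡ = solve 2 (λ T₁ T₂ → T₂ := con 1ℚ :* T₂ :- con 0ℚ :* T₁) refl t₁ t₂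

  wt-suc₁ : ∀ a b → - t₁ + wt a b ≡ wt a (suc b)
  wt-suc₁ a b = begin
    - t₁ + wt a b         ≡⟨ cong (_+ wt a b) t₁≡ ⟩
    wt 0 1 + wt a b       ≡⟨ wt-+ 0 1 a b ⟨
    wt a (suc b)          ∎
    where open ≡-Reasoning
          t₁≡ : - t₁ ≡ wt 0 1
          t₁≡ = solve 2 (λ T₁ T₂ → :- T₁ := con 0ℚ :* T₂ :- con 1ℚ :* T₁) refl t₁ t₂

  wt-+-t₁ : ∀ a b → wt a b + ℕ→ℚ b * t₁ ≡ 0ℚ + ℕ→ℚ a * t₂
  wt-+-t₁ a b = solve 4 (λ A B T₁ T₂ → (A :* T₂ :- B :* T₁) :+ B :* T₁ := con 0ℚ :+ A :* T₂)
                  refl (ℕ→ℚ a) (ℕ→ℚ b) t₁ t₂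

  0≤wt⇔ : ∀ a b → (0ℚ ≤ wt a b) ⇔ (ℕ→ℚ b * t₁ ≤ ℕ→ℚ a * t₂)
  0≤wt⇔ a b = +-≡⇒≤⇔ 0ℚ (wt a b) (ℕ→ℚ a * t₂) (ℕ→ℚ b * t₁)
                (sym (wt-+-t₁ a b))

  wt-extend-≤⇔ : ∀ j r a b → (wt (j ℕ.+ a) (r ℕ.+ b) ≤ wt j r) ⇔ (ℕ→ℚ a * t₂ ≤ ℕ→ℚ b * t₁)
  wt-extend-≤⇔ j r a b = +-≡⇒≤⇔ _ _ _ _ key
    where
    key : wt (j ℕ.+ a) (r ℕ.+ b) + ℕ→ℚ b * t₁ ≡ wt j r + ℕ→ℚ a * t₂
    key = begin
      wt (j ℕ.+ a) (r ℕ.+ b) + ℕ→ℚ b * t₁    ≡⟨ cong (_+ ℕ→ℚ b * t₁) (wt-+ j r a b) ⟩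
      (wt j r + wt a b) + ℕ→ℚ b * t₁          ≡⟨ ℚP.+-assoc (wt j r) (wt a b) _ ⟩
      wt j r + (wt a b + ℕ→ℚ b * t₁)          ≡⟨ cong (wt j r +_) (trans (wt-+-t₁ a b) (ℚP.+-identityˡ _)) ⟩
      wt j r + ℕ→ℚ a * t₂                     ∎
      where open ≡-Reasoning

  ratio : ℕ → ℚ → ℕ → ℚ → ℚ
  ratio n h j hⱼ = (h - hⱼ) /ₜ (ℕ→ℚ n - lval t₁ t₂ j hⱼ)

  module _ (t₁>0 : 0ℚ < t₁) where

    wt-antitone : ∀ a r b → (wt a r ≤ wt a b) ⇔ (b ℕ.≤ r)
    wt-antitone a r b = ⇔-trans
      (+-≡⇒≤⇔ (wt a r) (wt a b) (ℕ→ℚ r * t₁) (ℕ→ℚ b * t₁) (trans (wt-+-t₁ a r) (sym (wt-+-t₁ a b))))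
      (ℕ→ℚ-scaled-≤⇔ b r t₁>0)

    lval-wt : ∀ i r → lval t₁ t₂ i (wt i r) ≡ ℕ→ℚ (i ℕ.+ r)
    lval-wt i r = begin
      ℕ→ℚ i + ((ℕ→ℚ i * t₂ - wt i r) /ₜ t₁)  ≡⟨ cong (λ z → ℕ→ℚ i + (z /ₜ t₁)) cancel ⟩
      ℕ→ℚ i + ((ℕ→ℚ r * t₁) /ₜ t₁)           ≡⟨ cong (ℕ→ℚ i +_) (*-/ₜ-cancel (ℕ→ℚ r) t₁ (pos⇒≢0 t₁>0)) ⟩
      ℕ→ℚ i + ℕ→ℚ r                          ≡⟨ ℕ→ℚ-+ i r ⟨
      ℕ→ℚ (i ℕ.+ r)                          ∎
      where
      open ≡-Reasoning
      cancel : ℕ→ℚ i * t₂ - wt i r ≡ ℕ→ℚ r * t₁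
      cancel = solve 4 (λ I T₂ R T₁ → I :* T₂ :- (I :* T₂ :- R :* T₁) := R :* T₁)
                 refl (ℕ→ℚ i) t₂ (ℕ→ℚ r) t₁

    ratio-wt : ∀ n j r a b → n ≡ (j ℕ.+ a) ℕ.+ (r ℕ.+ b) →
               ratio n (wt (j ℕ.+ a) (r ℕ.+ b)) j (wt j r) ≡ mean a b
    ratio-wt n j r a b refl = cong₂ _/ₜ_ numerator denominator
      where
      open ≡-Reasoning
      numerator : wt (j ℕ.+ a) (r ℕ.+ b) - wt j r ≡ wt a b
      numerator = begin
        wt (j ℕ.+ a) (r ℕ.+ b) - wt j r  ≡⟨ cong (_- wt j r) (wt-+ j r a b) ⟩
        (wt j r + wt a b) - wt j r       ≡⟨ solve 2 (λ x y → (x :+ y) :- x := y) refl (wt j r) (wt a b) ⟩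
        wt a b                           ∎
      denominator : ℕ→ℚ ((j ℕ.+ a) ℕ.+ (r ℕ.+ b)) - lval t₁ t₂ j (wt j r) ≡ ℕ→ℚ (a ℕ.+ b)
      denominator = begin
        ℕ→ℚ ((j ℕ.+ a) ℕ.+ (r ℕ.+ b)) - lval t₁ t₂ j (wt j r)
          ≡⟨ cong₂ _-_ (cong ℕ→ℚ (regroup j a r b)) (lval-wt j r) ⟩
        ℕ→ℚ ((j ℕ.+ r) ℕ.+ (a ℕ.+ b)) - ℕ→ℚ (j ℕ.+ r)
          ≡⟨ cong (_- ℕ→ℚ (j ℕ.+ r)) (ℕ→ℚ-+ (j ℕ.+ r) (a ℕ.+ b)) ⟩
        (ℕ→ℚ (j ℕ.+ r) + ℕ→ℚ (a ℕ.+ b)) - ℕ→ℚ (j ℕ.+ r)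
          ≡⟨ solve 2 (λ x y → (x :+ y) :- x := y) refl (ℕ→ℚ (j ℕ.+ r)) (ℕ→ℚ (a ℕ.+ b)) ⟩
        ℕ→ℚ (a ℕ.+ b)  ∎
        where
        regroup : ∀ j a r b → (j ℕ.+ a) ℕ.+ (r ℕ.+ b) ≡ (j ℕ.+ r) ℕ.+ (a ℕ.+ b)
        regroup = solve-∀

    module _ (t₂>0 : 0ℚ < t₂) where

      mean-≤⇔ : ∀ a b a′ b′ → 0 ℕ.< a ℕ.+ b → 0 ℕ.< a′ ℕ.+ b′ →
                (mean a b ≤ mean a′ b′) ⇔ (a ℕ.* b′ ℕ.≤ a′ ℕ.* b)
      mean-≤⇔ a b a′ b′ 0<a+b 0<a′+b′ = ⇔-trans
        (/ₜ-≤⇔cross (wt a b) (wt a′ b′) _ _ (ℕ→ℚ-mono-< 0<a+b) (ℕ→ℚ-mono-< 0<a′+b′))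
        (⇔-trans (+-≡⇒≤⇔ _ _ _ _ key) (ℕ→ℚ-scaled-≤⇔ (a ℕ.* b′) (a′ ℕ.* b) s>0))
        where
        s : ℚ
        s = t₁ + t₂
        s>0 : 0ℚ < s
        s>0 = ℚP.positive⁻¹ s {{ℚP.pos+pos⇒pos t₁ {{ℚ.positive t₁>0}} t₂ {{ℚ.positive t₂>0}}}}
        key : wt a b * ℕ→ℚ (a′ ℕ.+ b′) + ℕ→ℚ (a′ ℕ.* b) * s
            ≡ wt a′ b′ * ℕ→ℚ (a ℕ.+ b) + ℕ→ℚ (a ℕ.* b′) * s
        key rewrite ℕ→ℚ-+ a b | ℕ→ℚ-+ a′ b′ | ℕ→ℚ-* a′ b | ℕ→ℚ-* a b′ =
          solve 6 (λ A B A′ B′ T₁ T₂ →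
                     (A :* T₂ :- B :* T₁) :* (A′ :+ B′) :+ (A′ :* B) :* (T₁ :+ T₂)
                  := (A′ :* T₂ :- B′ :* T₁) :* (A :+ B) :+ (A :* B′) :* (T₁ :+ T₂))
            refl (ℕ→ℚ a) (ℕ→ℚ b) (ℕ→ℚ a′) (ℕ→ℚ b′) t₁ t₂

module FiniteSearch where
  open import Data.Nat using (_≤_; _<_; z≤n)
  open import Data.List as L using (List; []; _∷_)
  open import Data.List.Membership.Propositional using (_∈_)
  import Data.List.Membership.Propositional.Properties as ∈P
  open import Data.List.Relation.Unary.Any using (here; there)
  open import Data.Product using (Σ; _×_)
  open import Data.Sum using (_⊎_; inj₁; inj₂)
  open import Relation.Nullary using (¬_; Dec)
  open import Data.Rational using () renaming (_≤_ to _≤ℚ_)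

  largest : (P : ℕ → Set) → (∀ r → Dec (P r)) → (B : ℕ) → (∀ r → P r → r ≤ B) → ∀ r₀ → P r₀ →
            Σ ℕ λ R → P R × (∀ r → P r → r ≤ R)
  largest P P? B bound r₀ p₀ with P? B
  ... | yes pB = B , pB , bound
  largest P P? zero bound r₀ p₀ | no ¬pB with bound r₀ p₀
  ... | z≤n = ⊥-elim (¬pB p₀)
  largest P P? (suc B) bound r₀ p₀ | no ¬pB = largest P P? B bound′ r₀ p₀
    where
    bound′ : ∀ r → P r → r ≤ B
    bound′ r pr with ℕP.m≤n⇒m<n∨m≡n (bound r pr)
    ... | inj₁ r<1+B = ℕP.≤-pred r<1+B
    ... | inj₂ refl  = ⊥-elim (¬pB pr)

  argmin : ∀ {A : Set} (P : A → Set) → (∀ x → Dec (P x)) → (f : A → ℚ) → (xs : List A) →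
           (∀ {x} → x ∈ xs → ¬ P x) ⊎ Σ A (λ x → P x × (∀ {y} → y ∈ xs → P y → f x ≤ℚ f y))
  argmin P P? f [] = inj₁ λ ()
  argmin P P? f (x ∷ xs) with argmin P P? f xs | P? x
  ... | inj₁ none | no ¬px = inj₁ λ { (here refl) → ¬px ; (there i) → none i }
  ... | inj₁ none | yes px = inj₂ (x , px , λ { (here refl) _ → ℚP.≤-refl ; (there i) py → ⊥-elim (none i py) })
  ... | inj₂ (m , pm , min) | no ¬px = inj₂ (m , pm , λ { (here refl) py → ⊥-elim (¬px py) ; (there i) py → min i py })
  ... | inj₂ (m , pm , min) | yes px with ℚP.≤-total (f m) (f x)
  ...   | inj₁ fm≤fx = inj₂ (m , pm , λ { (here refl) _ → fm≤fx ; (there i) py → min i py })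
  ...   | inj₂ fx≤fm = inj₂ (x , px , λ { (here refl) _ → ℚP.≤-refl ; (there i) py → ℚP.≤-trans fx≤fm (min i py) })

  pairsBelow : ℕ → ℕ → List (ℕ × ℕ)
  pairsBelow N M = L.cartesianProduct (L.downFrom N) (L.downFrom M)

  ∈-pairsBelow : ∀ {k a N M} → k < N → a < M → (k , a) ∈ pairsBelow N M
  ∈-pairsBelow k<N a<M = ∈P.∈-cartesianProduct⁺ (∈P.∈-downFrom⁺ k<N) (∈P.∈-downFrom⁺ a<M)

  minimum-below : (P : ℕ × ℕ → Set) → (∀ c → Dec (P c)) → (f : ℕ × ℕ → ℚ) → ∀ N M {k₀ a₀} →
                  k₀ < N → a₀ < M → P (k₀ , a₀) →
                  Σ (ℕ × ℕ) λ c → P c × (∀ k a → k < N → a < M → P (k , a) → f c ≤ℚ f (k , a))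
  minimum-below P P? f N M k₀<N a₀<M p₀ with argmin P P? f (pairsBelow N M)
  ... | inj₁ none          = ⊥-elim (none (∈-pairsBelow k₀<N a₀<M) p₀)
  ... | inj₂ (c , pc , min) = c , pc , λ k a k<N a<M pka → min (∈-pairsBelow k<N a<M) pka

open FiniteSearch

module Walks {n : ℕ} (E : Fin n → Fin n → Bool) where
  open import Data.Nat using (_+_; _≤_; _<_; z≤n; s≤s)
  open import Data.List as L using (List; []; _∷_; length)
  open import Data.List.Relation.Unary.All as All using (All)
  import Data.List.Relation.Unary.All.Properties as AllP
  open import Data.List.Relation.Unary.AllPairs as AllPairs using (AllPairs)
  open import Data.List.Relation.Unary.Any using (here; there)
  open import Data.List.Membership.DecPropositional (FinP._≟_ {n}) using (_∈_; _∉_; _∈?_)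
  open import Data.Product using (Σ; ∃; _×_; proj₁)
  open import Data.Sum using (_⊎_; inj₁; inj₂)
  open import Relation.Nullary using (Dec; ¬?)
  import Data.Bool.Properties as BoolP
  open import Relation.Nullary.Decidable using (map′; _×-dec_; _⊎-dec_)

  infixr 5 _++ʷ_
  _++ʷ_ : ∀ {x y z} → DWalk E x y → DWalk E y z → DWalk E x z
  []      ++ʷ q = q
  (e ∷ p) ++ʷ q = e ∷ (p ++ʷ q)

  #t₁ : ∀ {x y} → DWalk E x y → ℕ
  #t₁ []              = 0
  #t₁ (rev _ ∷ w)     = suc (#t₁ w)
  #t₁ (non _ _ _ ∷ w) = #t₁ w

  len-split : ∀ {x y} (w : DWalk E x y) → len w ≡ #t₂ w + #t₁ w
  len-split []              = refl
  len-split (rev _ ∷ w)     = trans (cong suc (len-split w)) (sym (ℕP.+-suc (#t₂ w) (#t₁ w)))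
  len-split (non _ _ _ ∷ w) = cong suc (len-split w)

  #t₂≤len : ∀ {x y} (w : DWalk E x y) → #t₂ w ≤ len w
  #t₂≤len w = subst (#t₂ w ≤_) (sym (len-split w)) (ℕP.m≤m+n (#t₂ w) (#t₁ w))

  #t₁≤len : ∀ {x y} (w : DWalk E x y) → #t₁ w ≤ len w
  #t₁≤len w = subst (#t₁ w ≤_) (sym (len-split w)) (ℕP.m≤n+m (#t₁ w) (#t₂ w))

  len-++ : ∀ {x y z} (p : DWalk E x y) (q : DWalk E y z) → len (p ++ʷ q) ≡ len p + len q
  len-++ []      q = refl
  len-++ (e ∷ p) q = cong suc (len-++ p q)

  #t₂-++ : ∀ {x y z} (p : DWalk E x y) (q : DWalk E y z) → #t₂ (p ++ʷ q) ≡ #t₂ p + #t₂ q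
  #t₂-++ []      q = refl
  #t₂-++ (e ∷ p) q = trans (cong (isT₂ e +_) (#t₂-++ p q)) (sym (ℕP.+-assoc (isT₂ e) (#t₂ p) (#t₂ q)))

  #t₁-++ : ∀ {x y z} (p : DWalk E x y) (q : DWalk E y z) → #t₁ (p ++ʷ q) ≡ #t₁ p + #t₁ q
  #t₁-++ []              q = refl
  #t₁-++ (rev _ ∷ p)     q = cong suc (#t₁-++ p q)
  #t₁-++ (non _ _ _ ∷ p) q = #t₁-++ p q

  cut-cycle : (f : ∀ {x y} → DWalk E x y → ℕ) →
              (∀ {x y z} (p : DWalk E x y) (q : DWalk E y z) → f (p ++ʷ q) ≡ f p + f q) →
              ∀ {x u y} (P : DWalk E x u) (C : DWalk E u u) (Q : DWalk E u y) →
              f (P ++ʷ (C ++ʷ Q)) ≡ f (P ++ʷ Q) + f C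
  cut-cycle f f-++ P C Q = begin
    f (P ++ʷ (C ++ʷ Q))   ≡⟨ f-++ P (C ++ʷ Q) ⟩
    f P + f (C ++ʷ Q)     ≡⟨ cong (f P +_) (f-++ C Q) ⟩
    f P + (f C + f Q)     ≡⟨ regroup (f P) (f C) (f Q) ⟩
    (f P + f Q) + f C     ≡⟨ cong (_+ f C) (f-++ P Q) ⟨
    f (P ++ʷ Q) + f C     ∎
    where
    open ≡-Reasoning
    regroup : ∀ a b c → a + (b + c) ≡ (a + c) + b
    regroup = solve-∀

  vertices : ∀ {x y} → DWalk E x y → List (Fin n)
  vertices {x} []      = x ∷ []
  vertices {x} (e ∷ w) = x ∷ vertices w

  vertices-++ : ∀ {x y z} (p : DWalk E x y) (q : DWalk E y z) → vertices (p ++ʷ q) ≡ starts p L.++ vertices q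
  vertices-++ []      q = refl
  vertices-++ (e ∷ p) q = cong (_ ∷_) (vertices-++ p q)

  length-vertices : ∀ {x y} (w : DWalk E x y) → length (vertices w) ≡ suc (len w)
  length-vertices []      = refl
  length-vertices (e ∷ w) = cong suc (length-vertices w)

  length-starts : ∀ {x y} (w : DWalk E x y) → length (starts w) ≡ len w
  length-starts []      = refl
  length-starts (e ∷ w) = cong suc (length-starts w)

  unique-length≤ : ∀ {xs : List (Fin n)} → Unique xs → length xs ≤ n
  unique-length≤ {xs} u with length xs ℕP.≤? n
  ... | yes ≤n = ≤n
  ... | no  ≰n with FinP.pigeonhole (ℕP.≰⇒> ≰n) (L.lookup xs)
  ...   | i , j , i<j , same = ⊥-elim (distinct u i j i<j same)
    where
    lookup-∉ : ∀ {x} {ys : List (Fin n)} → All (x ≢_) ys → (j : Fin (length ys)) → x ≢ L.lookup ys j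
    lookup-∉ (x≢y All.∷ _)  Fin.zero    = x≢y
    lookup-∉ (_ All.∷ x≢ys) (Fin.suc j) = lookup-∉ x≢ys j
    distinct : ∀ {ys : List (Fin n)} → Unique ys → (i j : Fin (length ys)) → i Fin.< j →
               L.lookup ys i ≢ L.lookup ys j
    distinct (x∉ AllPairs.∷ _) Fin.zero    (Fin.suc j) _         = lookup-∉ x∉ j
    distinct (_ AllPairs.∷ u) (Fin.suc i) (Fin.suc j) (s≤s i<j) = distinct u i j i<j

  cycle-len≤ : ∀ {x} (C : DWalk E x x) → IsCycle C → len C ≤ n
  cycle-len≤ C (_ , u) = subst (_≤ n) (length-starts C) (unique-length≤ u)

  path-len< : ∀ {x y} (w : DWalk E x y) → Unique (vertices w) → len w < n
  path-len< w u = subst (_≤ n) (length-vertices w) (unique-length≤ u)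

  split-at-first : ∀ {x y} z (w : DWalk E x y) → z ∈ vertices w →
                   Σ (DWalk E x z) λ A → Σ (DWalk E z y) λ B → (w ≡ A ++ʷ B) × (z ∉ starts A)
  split-at-first {x} z w z∈ with z FinP.≟ x
  split-at-first {x} z w       z∈          | yes refl = [] , w , refl , λ ()
  split-at-first {x} z []      (here z≡x)  | no z≢x   = ⊥-elim (z≢x z≡x)
  split-at-first {x} z (e ∷ w) (here z≡x)  | no z≢x   = ⊥-elim (z≢x z≡x)
  split-at-first {x} z (e ∷ w) (there z∈)  | no z≢x with split-at-first z w z∈
  ... | A , B , refl , z∉A = e ∷ A , B , refl , λ { (here z≡x) → z≢x z≡x ; (there z∈A) → z∉A z∈A }

  CycleIn : ∀ {x y} → DWalk E x y → Set
  CycleIn {x} {y} w = Σ (Fin n) λ u → Σ (DWalk E x u) λ P → Σ (DWalk E u u) λ C → Σ (DWalk E u y) λ Q →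
                        (w ≡ P ++ʷ (C ++ʷ Q)) × IsCycle C

  path-or-cycle : ∀ {x y} (w : DWalk E x y) → Unique (vertices w) ⊎ CycleIn w
  path-or-cycle [] = inj₁ (All.[] AllPairs.∷ AllPairs.[])
  path-or-cycle {x} (e ∷ w) with path-or-cycle w
  ... | inj₂ (u , P , C , Q , refl , cyc) = inj₂ (u , e ∷ P , C , Q , refl , cyc)
  ... | inj₁ path with x ∈? vertices w
  ...   | no x∉ = inj₁ (AllP.¬Any⇒All¬ (vertices w) x∉ AllPairs.∷ path)
  ...   | yes x∈ with split-at-first x w x∈
  ...     | A , B , refl , x∉A =
    inj₂ (x , [] , e ∷ A , B , refl , s≤s z≤n , AllP.¬Any⇒All¬ (starts A) x∉A AllPairs.∷ unique-prefix path)
    where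
    unique-prefix′ : ∀ {xs ys : List (Fin n)} → Unique (xs L.++ ys) → Unique xs
    unique-prefix′ {[]}     _               = AllPairs.[]
    unique-prefix′ {_ ∷ xs} (x∉ AllPairs.∷ u) = AllP.++⁻ˡ xs x∉ AllPairs.∷ unique-prefix′ u
    unique-prefix : Unique (vertices (A ++ʷ B)) → Unique (starts A)
    unique-prefix u = unique-prefix′ (subst Unique (vertices-++ A B) u)

  reverse-to-G : ∀ {x y} (w : DWalk E x y) → #t₂ w ≡ 0 → EWalk E (len w) y x
  reverse-to-G []              _ = []
  reverse-to-G (rev p ∷ w)     h = snoc (reverse-to-G w h) p
    where
    snoc : ∀ {k x y z} → EWalk E k x y → E y z ≡ true → EWalk E (suc k) x z
    snoc []      q = q ∷ []
    snoc (r ∷ v) q = r ∷ snoc v q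
  reverse-to-G (non _ _ _ ∷ w) ()

  Walks : ℕ → ℕ → Fin n → Fin n → Set
  Walks k a x y = Σ (DWalk E x y) λ w → (len w ≡ k) × (#t₂ w ≡ a)

  NonAdj : Fin n → Fin n → Set
  NonAdj u v = (u ≢ v) × (E u v ≡ false) × (E v u ≡ false)

  nonAdj? : ∀ u v → Dec (NonAdj u v)
  nonAdj? u v = ¬? (u FinP.≟ v) ×-dec (E u v BoolP.≟ false) ×-dec (E v u BoolP.≟ false)

  -- There are finitely many walks of given length, so their existence is decidable.
  walks? : ∀ k a x y → Dec (Walks k a x y)
  walks? zero a x y with x FinP.≟ y | a ℕP.≟ 0
  ... | yes refl | yes refl = yes ([] , refl , refl)
  ... | no x≢y   | _        = no λ { ([] , _ , _) → x≢y refl ; (_ ∷ _ , () , _) }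
  ... | yes _    | no a≢0   = no λ { ([] , _ , a≡0) → a≢0 (sym a≡0) ; (_ ∷ _ , () , _) }
  walks? (suc k) a x y = map′ to from (FinP.any? first-step?)
    where
    FirstStep : Fin n → Set
    FirstStep z = (E z x ≡ true × Walks k a z y)
                ⊎ (Σ ℕ λ a′ → (a ≡ suc a′) × NonAdj x z × Walks k a′ z y)
    first-step? : ∀ z → Dec (FirstStep z)
    first-step? z = ((E z x BoolP.≟ true) ×-dec walks? k a z y) ⊎-dec t₂-step? a
      where
      t₂-step? : ∀ a → Dec (Σ ℕ λ a′ → (a ≡ suc a′) × NonAdj x z × Walks k a′ z y)
      t₂-step? zero     = no λ { (_ , () , _) }
      t₂-step? (suc a′) = map′ (λ { (nz , w) → a′ , refl , nz , w }) (λ { (_ , refl , nz , w) → nz , w })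
                            (nonAdj? x z ×-dec walks? k a′ z y)
    to : ∃ FirstStep → Walks (suc k) a x y
    to (z , inj₁ (p , w , l , t))                      = rev p ∷ w , cong suc l , t
    to (z , inj₂ (a′ , refl , (x≢z , f₁ , f₂) , w , l , t)) = non x≢z f₁ f₂ ∷ w , cong suc l , cong suc t
    from : Walks (suc k) a x y → ∃ FirstStep
    from (rev p ∷ w , l , t)           = _ , inj₁ (p , w , ℕP.suc-injective l , t)
    from (non x≢z f₁ f₂ ∷ w , l , refl) = _ , inj₂ (#t₂ w , refl , (x≢z , f₁ , f₂) , w , ℕP.suc-injective l , refl)

  ArrivesWith : Fin n → ℕ × ℕ → Set
  ArrivesWith v (k , a) = Σ (Fin n) λ x → Walks k a x v

  arrivesWith? : ∀ v c → Dec (ArrivesWith v c)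
  arrivesWith? v (k , a) = FinP.any? (λ x → walks? k a x v)

  ClosedWith : ℕ × ℕ → Set
  ClosedWith (k , a) = (1 ≤ k) × Σ (Fin n) λ x → Walks k a x x

  closedWith? : ∀ c → Dec (ClosedWith c)
  closedWith? (k , a) = (1 ℕP.≤? k) ×-dec FinP.any? (λ x → walks? k a x x)

  split-at-len : ∀ k {x y} (w : DWalk E x y) → k ≤ len w →
                 Σ (Fin n) λ z → Σ (DWalk E x z) λ A → Σ (DWalk E z y) λ B → (w ≡ A ++ʷ B) × (len A ≡ k)
  split-at-len zero    w       _         = _ , [] , w , refl , refl
  split-at-len (suc k) (e ∷ w) (s≤s k≤l) with split-at-len k w k≤l
  ... | z , A , B , refl , l = z , e ∷ A , B , refl , cong suc l

  repeat : ∀ {u} → ℕ → DWalk E u u → DWalk E u u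
  repeat zero    C = []
  repeat (suc m) C = C ++ʷ repeat m C

  len-repeat : ∀ {u} m (C : DWalk E u u) → 1 ≤ len C → m ≤ len (repeat m C)
  len-repeat zero    C _   = z≤n
  len-repeat (suc m) C 1≤C = subst (suc m ≤_) (sym (len-++ C (repeat m C))) (ℕP.+-mono-≤ 1≤C (len-repeat m C 1≤C))

  suffix-with-#t₂ : ∀ k {x y} (w : DWalk E x y) → k ≤ #t₂ w → Σ (Fin n) λ x′ → Σ (DWalk E x′ y) λ w′ → #t₂ w′ ≡ k
  suffix-with-#t₂ k {x} w k≤ with k ℕP.≟ #t₂ w
  ... | yes k≡ = x , w , sym k≡
  suffix-with-#t₂ k []              z≤n | no k≢ = ⊥-elim (k≢ refl)
  suffix-with-#t₂ k (rev _ ∷ w)     k≤  | no k≢ = suffix-with-#t₂ k w k≤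
  suffix-with-#t₂ k (non _ _ _ ∷ w) k≤  | no k≢ = suffix-with-#t₂ k w (ℕP.≤-pred (ℕP.≤∧≢⇒< k≤ k≢))

  cycle-induction : (Φ : ∀ {x y} → DWalk E x y → Set) →
    (∀ {x y} (w : DWalk E x y) → Unique (vertices w) → Φ w) →
    (∀ {x u y} (P : DWalk E x u) (C : DWalk E u u) (Q : DWalk E u y) → IsCycle C →
       Φ (P ++ʷ Q) → Φ (P ++ʷ (C ++ʷ Q))) →
    ∀ {x y} (w : DWalk E x y) → Φ w
  cycle-induction Φ path cycle w = go (suc (len w)) w ℕP.≤-refl
    where
    go : ∀ fuel {x y} (w : DWalk E x y) → len w < fuel → Φ w
    go (suc fuel) w len<fuel with path-or-cycle w
    ... | inj₁ isPath = path w isPath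
    ... | inj₂ (u , P , C , Q , refl , cyc) = cycle P C Q cyc (go fuel (P ++ʷ Q) shorter)
      where
      shorter : len (P ++ʷ Q) < fuel
      shorter = ℕP.<-≤-trans
        (subst (len (P ++ʷ Q) <_) (sym (cut-cycle len len-++ P C Q)) (ℕP.m<m+n (len (P ++ʷ Q)) (proj₁ cyc)))
        (ℕP.≤-pred len<fuel)

module Dag {n : ℕ} (E : Fin n → Fin n → Bool) (dag : IsDag E) where
  open Walks E
  open import Data.Nat using (_+_; _*_; _≤_; _<_; z≤n; s≤s)
  open import Data.List using (List; []; _∷_)
  open import Data.List.Relation.Unary.Any using (here; there)
  open import Data.List.Membership.DecPropositional (FinP._≟_ {n}) using (_∈_; _∉_; _∈?_)
  open import Data.Product using (Σ; _×_; proj₁; proj₂)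
  open import Data.Sum using (_⊎_; inj₁; inj₂)
  open import Data.Empty using (⊥)
  open import Relation.Nullary.Decidable using (_⊎-dec_)
  import Data.Bool.Properties as BoolP

  -- A closed walk of G_d using only (−t₁)-edges would be a directed cycle of G.
  closed-walk-has-t₂ : ∀ {x} (C : DWalk E x x) → 1 ≤ len C → 1 ≤ #t₂ C
  closed-walk-has-t₂ C 1≤len with #t₂ C in eq
  ... | suc _ = s≤s z≤n
  ... | zero with len C | reverse-to-G C eq
  ...   | suc _ | G-cycle = ⊥-elim (dag G-cycle)

  no-2-cycle : ∀ {x y} → E x y ≡ true → E y x ≡ true → ⊥
  no-2-cycle p q = dag (p ∷ (q ∷ []))

  -- Hence the number of (−t₁)-edges of a walk is bounded in terms of its t₂-edges:
  -- a path has fewer than n edges and every cycle has between 1 and n t₂-edges.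
  #t₁-bound : ∀ {x y} (w : DWalk E x y) → #t₁ w ≤ n + n * #t₂ w
  #t₁-bound = cycle-induction (λ w → #t₁ w ≤ n + n * #t₂ w) path-bound cycle-step
    where
    path-bound : ∀ {x y} (w : DWalk E x y) → Unique (vertices w) → #t₁ w ≤ n + n * #t₂ w
    path-bound w isPath = ℕP.≤-trans (#t₁≤len w) (ℕP.≤-trans (ℕP.<⇒≤ (path-len< w isPath)) (ℕP.m≤m+n n _))
    cycle-step : ∀ {x u y} (P : DWalk E x u) (C : DWalk E u u) (Q : DWalk E u y) → IsCycle C →
                 #t₁ (P ++ʷ Q) ≤ n + n * #t₂ (P ++ʷ Q) → #t₁ (P ++ʷ (C ++ʷ Q)) ≤ n + n * #t₂ (P ++ʷ (C ++ʷ Q))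
    cycle-step P C Q cyc ih = subst₂ _≤_ (sym (cut-cycle #t₁ #t₁-++ P C Q))
      (cong (λ t → n + n * t) (sym (cut-cycle #t₂ #t₂-++ P C Q)))
      (subst (#t₁ (P ++ʷ Q) + #t₁ C ≤_) (regroup n (#t₂ (P ++ʷ Q)) (#t₂ C))
        (ℕP.+-mono-≤ ih C-bound))
      where
      C-bound : #t₁ C ≤ n * #t₂ C
      C-bound = ℕP.≤-trans (#t₁≤len C) (ℕP.≤-trans (cycle-len≤ C cyc)
                  (subst (_≤ n * #t₂ C) (ℕP.*-identityʳ n) (ℕP.*-monoʳ-≤ n (closed-walk-has-t₂ C (proj₁ cyc)))))
      regroup : ∀ n a b → (n + n * a) + n * b ≡ n + n * (a + b)
      regroup = solve-∀

  -- R is the largest number of (−t₁)-edges of a walk ending at v with exactly i t₂-edges;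
  -- such a walk realises H(i,v), and then l(i,v) = i + R.
  MaxT₁ : ℕ → Fin n → ℕ → Set
  MaxT₁ i v R = (Σ (Fin n) λ x → Σ (DWalk E x v) λ w → (#t₂ w ≡ i) × (#t₁ w ≡ R))
              × (∀ x (w : DWalk E x v) → #t₂ w ≡ i → #t₁ w ≤ R)

  #t₁-from-len : ∀ {i r x y} (w : DWalk E x y) → len w ≡ i + r → #t₂ w ≡ i → #t₁ w ≡ r
  #t₁-from-len {i} w l t = ℕP.+-cancelˡ-≡ i _ _ (trans (cong (_+ #t₁ w) (sym t)) (trans (sym (len-split w)) l))

  -- If some walk ends at v with i t₂-edges then the maximum exists: the walks realising
  -- a given count r are decidable, and r is bounded by #t₁-bound.
  maxT₁-exists : ∀ {i x v} (w : DWalk E x v) → #t₂ w ≡ i → Σ ℕ (MaxT₁ i v)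
  maxT₁-exists {i} {x} {v} w refl =
    let (R , (x′ , w′ , l , t) , max) = largest Realised (λ r → arrivesWith? v (i + r , i)) (n + n * i) bound
                                                  (#t₁ w) (x , w , len-split w , refl)
    in R , (x′ , w′ , t , #t₁-from-len w′ l t) ,
       λ x″ w″ t″ → max (#t₁ w″) (x″ , w″ , trans (len-split w″) (cong (_+ #t₁ w″) t″) , t″)
    where
    Realised : ℕ → Set
    Realised r = ArrivesWith v (i + r , i)
    bound : ∀ r → Realised r → r ≤ n + n * i
    bound r (x′ , w′ , l , t) = subst₂ (λ a b → a ≤ n + n * b) (#t₁-from-len w′ l t) t (#t₁-bound w′)

  Absorbing : List (Fin n) → Set
  Absorbing S = (∀ z u → z ∈ S → u ∉ S → E u z ≡ true) × (∀ u z → u ∈ S → z ∈ S → NonAdj u z → ⊥)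

  absorbing-[] : Absorbing []
  absorbing-[] = (λ _ _ ()) , (λ _ _ ())

  Covered : List (Fin n) → Fin n → Set
  Covered S c = ∀ u → u ∉ S → u ≢ c → E u c ≡ true

  not-true : ∀ {b} → b ≢ true → b ≡ false
  not-true {false} _   = refl
  not-true {true}  b≢t = ⊥-elim (b≢t refl)

  true≢false : ∀ {b} → b ≡ true → b ≡ false → ⊥
  true≢false refl ()

  covered? : ∀ S c → Covered S c ⊎ (Σ (Fin n) λ u → u ∉ S × u ≢ c × E u c ≡ false)
  covered? S c with FinP.all? (λ u → (u ∈? S) ⊎-dec ((u FinP.≟ c) ⊎-dec (E u c BoolP.≟ true)))
  ... | yes all = inj₁ λ u u∉S u≢c → points (all u) u∉S u≢c
    where
    points : ∀ {u} → (u ∈ S) ⊎ ((u ≡ c) ⊎ (E u c ≡ true)) → u ∉ S → u ≢ c → E u c ≡ true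
    points (inj₁ u∈S)        u∉S _   = ⊥-elim (u∉S u∈S)
    points (inj₂ (inj₁ u≡c)) _   u≢c = ⊥-elim (u≢c u≡c)
    points (inj₂ (inj₂ e))   _   _   = e
  ... | no ¬all with FinP.¬∀⟶∃¬ n _ (λ u → (u ∈? S) ⊎-dec ((u FinP.≟ c) ⊎-dec (E u c BoolP.≟ true))) ¬all
  ... | u , ¬u = inj₂ (u , (λ u∈S → ¬u (inj₁ u∈S)) , (λ u≡c → ¬u (inj₂ (inj₁ u≡c))) , not-true (λ e → ¬u (inj₂ (inj₂ e))))

  absorbing-∷ : ∀ {S c} → Absorbing S → Covered S c → Absorbing (c ∷ S)
  absorbing-∷ {S} {c} (into , chain) cov = into′ , chain′
    where
    into′ : ∀ z u → z ∈ c ∷ S → u ∉ c ∷ S → E u z ≡ true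
    into′ z u (here refl) u∉ = cov u (λ u∈S → u∉ (there u∈S)) (λ u≡c → u∉ (here u≡c))
    into′ z u (there z∈S) u∉ = into z u z∈S (λ u∈S → u∉ (there u∈S))
    c-comparable : ∀ z → z ∈ S → NonAdj c z → ⊥
    c-comparable z z∈S nonAdj@(_ , Ecz≡f , _) with c ∈? S
    ... | yes c∈S = chain c z c∈S z∈S nonAdj
    ... | no  c∉S = true≢false (into z c z∈S c∉S) Ecz≡f
    chain′ : ∀ u z → u ∈ c ∷ S → z ∈ c ∷ S → NonAdj u z → ⊥
    chain′ u z (here refl) (here refl) (u≢z , _)        = u≢z refl
    chain′ u z (here refl) (there z∈S) nonAdj           = c-comparable z z∈S nonAdj
    chain′ u z (there u∈S) (here refl) (u≢z , f₁ , f₂)  = c-comparable u u∈S ((λ z≡u → u≢z (sym z≡u)) , f₂ , f₁)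
    chain′ u z (there u∈S) (there z∈S) nonAdj           = chain u z u∈S z∈S nonAdj

  absorbing-walk : ∀ {S} → Absorbing S → ∀ {x z} (w : DWalk E x z) → z ∈ S → (x ∈ S) × (#t₂ w ≡ 0)
  absorbing-walk abs [] z∈S = z∈S , refl
  absorbing-walk {S} abs@(into , chain) {x} (e ∷ w) z∈S with absorbing-walk abs w z∈S | x ∈? S | e
  ... | y∈S , t≡0 | yes x∈S | rev _            = x∈S , t≡0
  ... | y∈S , _   | yes x∈S | non x≢y f₁ f₂    = ⊥-elim (chain _ _ x∈S y∈S (x≢y , f₁ , f₂))
  ... | y∈S , _   | no  x∉S | rev p            = ⊥-elim (no-2-cycle (into _ x y∈S x∉S) p)
  ... | y∈S , _   | no  x∉S | non _ Exy≡f _    = ⊥-elim (true≢false (into _ x y∈S x∉S) Exy≡f)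

  absorbing-no-t₂ : ∀ {S c c′} → Absorbing S → c ∈ S → NonAdj c c′ → ⊥
  absorbing-no-t₂ {S} {c} {c′} (into , chain) c∈S (c≢c′ , f₁ , f₂) with c′ ∈? S
  ... | yes c′∈S = chain c c′ c∈S c′∈S (c≢c′ , f₁ , f₂)
  ... | no  c′∉S = true≢false (into c c′ c∈S c′∉S) f₂

  snoc-rev : ∀ {x c u} (pre : DWalk E x c) (p : E u c ≡ true) →
             (#t₂ (pre ++ʷ (rev p ∷ [])) ≡ #t₂ pre) × (#t₁ (pre ++ʷ (rev p ∷ [])) ≡ suc (#t₁ pre))
  snoc-rev pre p = trans (#t₂-++ pre (rev p ∷ [])) (ℕP.+-identityʳ _) ,
                   trans (#t₁-++ pre (rev p ∷ [])) (ℕP.+-comm _ 1)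

  -- The heart of the monotonicity of l(·,v).  Let R be the largest number of (−t₁)-edges of
  -- a walk ending at v with k t₂-edges, and let V be some walk ending at v with k+1 t₂-edges.
  -- Walking backwards from the start of an optimal walk along (−t₁)-edges while the visited
  -- set stays absorbing, we either find a vertex from which a t₂-edge can be prepended
  -- without losing (−t₁)-edges, or (at the end of the walk) V would be t₂-free.
  module Peel {v : Fin n} {k R : ℕ} (optimal : ∀ x (w : DWalk E x v) → #t₂ w ≡ k → #t₁ w ≤ R)
              {y : Fin n} (V : DWalk E y v) (#t₂V : #t₂ V ≡ suc k) where

    Goal : Set
    Goal = Σ (Fin n) λ x → Σ (DWalk E x v) λ w → (#t₂ w ≡ suc k) × (R ≤ #t₁ w)

    Reach : List (Fin n) → ℕ → Set
    Reach S s = ∀ u → u ∉ S → Σ (Fin n) λ x → Σ (DWalk E x u) λ p → (#t₂ p ≡ 0) × (#t₁ p ≡ s)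

    -- Reach u by a t₂-free walk with s (−t₁)-edges
    -- and continue to c: along a (−t₁)-edge this would beat the optimum R, so u and c are
    -- non-adjacent and the t₂-edge u → c gives the goal.
    escape : ∀ {S s c u} → Reach S s → u ∉ S → u ≢ c → E u c ≡ false →
             (suf : DWalk E c v) → #t₂ suf ≡ k → s + #t₁ suf ≡ R → Goal
    escape {S} {s} {c} {u} reach u∉S u≢c Euc≡f suf t r with E c u BoolP.≟ true | reach u u∉S
    ... | yes Ecu | x , p , p₀ , pₛ = ⊥-elim (ℕP.<-irrefl refl (ℕP.<-≤-trans R<t₁ (optimal x w t₂≡)))
      where
      w : DWalk E x v
      w = p ++ʷ (rev Ecu ∷ suf)
      t₂≡ : #t₂ w ≡ k
      t₂≡ = trans (#t₂-++ p (rev Ecu ∷ suf)) (trans (cong (_+ #t₂ suf) p₀) t)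
      R<t₁ : R < #t₁ w
      R<t₁ = subst (R <_) (sym (trans (#t₁-++ p (rev Ecu ∷ suf)) (trans (cong (_+ suc (#t₁ suf)) pₛ) (ℕP.+-suc s (#t₁ suf)))))
                          (subst (λ m → R < suc m) (sym r) ℕP.≤-refl)
    ... | no ¬Ecu | x , p , p₀ , pₛ = x , w , t₂≡ , ℕP.≤-reflexive (sym t₁≡)
      where
      w : DWalk E x v
      w = p ++ʷ (non u≢c Euc≡f (not-true ¬Ecu) ∷ suf)
      t₂≡ : #t₂ w ≡ suc k
      t₂≡ = trans (#t₂-++ p _) (trans (cong (_+ suc (#t₂ suf)) p₀) (cong suc t))
      t₁≡ : #t₁ w ≡ R
      t₁≡ = trans (#t₁-++ p _) (trans (cong (_+ #t₁ suf) pₛ) r)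

    -- Invariant: pre ++ suf is an optimal walk for k (so s + #t₁ suf = R), pre is t₂-free
    -- and S, the set of vertices passed by pre, is absorbing and reachable as above.
    -- If c is covered by S then suf cannot be empty or start with a t₂-edge, so it starts
    -- with a (−t₁)-edge c → c′ and we move c into S.
    peel : ∀ S → Absorbing S → ∀ s {x₀ c} (pre : DWalk E x₀ c) → #t₂ pre ≡ 0 → #t₁ pre ≡ s → Reach S s →
           (suf : DWalk E c v) → #t₂ suf ≡ k → s + #t₁ suf ≡ R → Goal
    peel S abs s {c = c} pre pre₀ preₛ reach suf t r with covered? S c
    ... | inj₂ (u , u∉S , u≢c , Euc≡f) = escape reach u∉S u≢c Euc≡f suf t r
    ... | inj₁ cov with suf
    ...   | [] = ⊥-elim (ℕP.0≢1+n (trans (sym (proj₂ (absorbing-walk (absorbing-∷ abs cov) V (here refl)))) #t₂V))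
    ...   | non c≢c′ f₁ f₂ ∷ _ = ⊥-elim (absorbing-no-t₂ (absorbing-∷ abs cov) (here refl) (c≢c′ , f₁ , f₂))
    ...   | rev p ∷ suf′ = peel (c ∷ S) (absorbing-∷ abs cov) (suc s) (pre ++ʷ (rev p ∷ []))
              (trans (proj₁ (snoc-rev pre p)) pre₀) (trans (proj₂ (snoc-rev pre p)) (cong suc preₛ))
              reach′ suf′ t (trans (sym (ℕP.+-suc s (#t₁ suf′))) r)
      where
      reach′ : Reach (c ∷ S) (suc s)
      reach′ u u∉ = _ , pre ++ʷ (rev Euc ∷ []) , trans (proj₁ (snoc-rev pre Euc)) pre₀ ,
                    trans (proj₂ (snoc-rev pre Euc)) (cong suc preₛ)
        where
        Euc : E u c ≡ true
        Euc = cov u (λ u∈S → u∉ (there u∈S)) (λ u≡c → u∉ (here u≡c))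

  maxT₁-step : ∀ {k v R R′} → MaxT₁ k v R → MaxT₁ (suc k) v R′ → R ≤ R′
  maxT₁-step ((x₀ , w , t , r) , optimal) ((_ , V , #t₂V , _) , optimal′)
    with Peel.peel optimal V #t₂V [] absorbing-[] 0 [] refl refl (λ u _ → u , [] , refl , refl) w t r
  ... | x , w′ , t′ , R≤ = ℕP.≤-trans R≤ (optimal′ x w′ t′)

  maxT₁-mono : ∀ {j i v Rⱼ Rᵢ} → MaxT₁ j v Rⱼ → MaxT₁ i v Rᵢ → j ≤ i → Rⱼ ≤ Rᵢ
  maxT₁-mono {j} {i} mⱼ mᵢ j≤i with ℕP.m≤n⇒m<n∨m≡n j≤i
  maxT₁-mono ((x , w , t , r) , _) (_ , optimal) _ | inj₂ refl = subst (_≤ _) r (optimal x w t)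
  maxT₁-mono {j} {suc i} mⱼ mᵢ@((x , w , t , _) , _) _ | inj₁ j<1+i
    with suffix-with-#t₂ i w (subst (i ≤_) (sym t) (ℕP.n≤1+n i))
  ... | x′ , w′ , t′ with maxT₁-exists w′ t′
  ...   | R′ , m′ = ℕP.≤-trans (maxT₁-mono mⱼ m′ (ℕP.≤-pred j<1+i)) (maxT₁-step m′ mᵢ)

module MinMeanCycle {n : ℕ} (E : Fin n → Fin n → Bool) (dag : IsDag E)
                    (t₁ t₂ : ℚ) (t₁>0 : 0ℚ ℚ.< t₁) (t₂>0 : 0ℚ ℚ.< t₂) where
  open Walks E
  open Dag E dag
  open ProfileWeight t₁ t₂
  open import Data.Rational using (_+_; _-_; -_; _≤_)
  open import Data.Nat using (z≤n; s≤s)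
  open import Data.Product using (Σ; _×_; proj₁; proj₂)
  open import Data.Sum using (_⊎_; inj₁; inj₂)
  open Equivalence using (to; from)

  weight≡wt : ∀ {x y} (w : DWalk E x y) → weight t₁ t₂ w ≡ wt (#t₂ w) (#t₁ w)
  weight≡wt []              = sym wt-zero
  weight≡wt (rev _ ∷ w)     = trans (cong (- t₁ +_) (weight≡wt w)) (wt-suc₁ (#t₂ w) (#t₁ w))
  weight≡wt (non _ _ _ ∷ w) = trans (cong (t₂ +_) (weight≡wt w)) (wt-suc₂ (#t₂ w) (#t₁ w))

  meanWeight≡mean : ∀ {x y} (w : DWalk E x y) → meanWeight t₁ t₂ w ≡ mean (#t₂ w) (#t₁ w)
  meanWeight≡mean w = cong₂ _/ₜ_ (weight≡wt w) (cong ℕ→ℚ (len-split w))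

  weight≡wt-at : ∀ {i x y} (w : DWalk E x y) → #t₂ w ≡ i → weight t₁ t₂ w ≡ wt i (#t₁ w)
  weight≡wt-at w refl = weight≡wt w

  -- H(i,v) = wt i R for the maximal number R of (−t₁)-edges (weight decreases with #t₁).
  IsH→MaxT₁ : ∀ {i v h} → IsH E t₁ t₂ i v h → Σ ℕ λ R → MaxT₁ i v R × (h ≡ wt i R)
  IsH→MaxT₁ {i} {v} {h} ((x , w , t , wh) , least) = #t₁ w , ((x , w , t , refl) , max) , h≡
    where
    h≡ : h ≡ wt i (#t₁ w)
    h≡ = trans (sym wh) (weight≡wt-at w t)
    max : ∀ x′ (w′ : DWalk E x′ v) → #t₂ w′ ≡ i → #t₁ w′ ℕ.≤ #t₁ w
    max x′ w′ t′ = to (wt-antitone t₁>0 i (#t₁ w) (#t₁ w′)) (subst₂ _≤_ h≡ (weight≡wt-at w′ t′) (least x′ w′ t′))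

  MaxT₁→IsH : ∀ {i v R} → MaxT₁ i v R → IsH E t₁ t₂ i v (wt i R)
  MaxT₁→IsH {i} {v} {R} ((x , w , t , r) , max) =
    (x , w , t , trans (weight≡wt w) (cong₂ wt t r)) ,
    λ x′ w′ t′ → subst (wt i R ≤_) (sym (weight≡wt-at w′ t′)) (from (wt-antitone t₁>0 i R (#t₁ w′)) (max x′ w′ t′))

  lval≡n : ∀ i R → lval t₁ t₂ i (wt i R) ≡ ℕ→ℚ n → i ℕ.+ R ≡ n
  lval≡n i R l≡n = ℕ→ℚ-injective (trans (sym (lval-wt t₁>0 i R)) l≡n)

  ratio≡mean : ∀ i R j Rⱼ a b → i ≡ j ℕ.+ a → R ≡ Rⱼ ℕ.+ b → i ℕ.+ R ≡ n →
               ratio n (wt i R) j (wt j Rⱼ) ≡ mean a b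
  ratio≡mean _ _ j Rⱼ a b refl refl i+R≡n = ratio-wt t₁>0 n j Rⱼ a b (sym i+R≡n)

  0<a+b : ∀ {a} b → 1 ℕ.≤ a → 0 ℕ.< a ℕ.+ b
  0<a+b {suc a} b _ = s≤s z≤n

  CycleBelow : ℕ → Fin n → ℚ → Set
  CycleBelow i v h = Σ (Fin n) λ x → Σ (DWalk E x x) λ C → IsCycle C × Σ ℕ λ j → Σ ℚ λ hⱼ →
                     (j ℕ.< i) × IsH E t₁ t₂ j v hⱼ × (meanWeight t₁ t₂ C ≤ ratio n h j hⱼ)

  -- Let W = P ++ C ++ Q be an optimal walk for H(i,v) with
  -- n edges, C a cycle.  Cutting C out leaves j < i t₂-edges, and by monotonicity the
  -- quotient for j is the mean weight of a profile (#t₂ C , b′) with b′ ≤ #t₁ C, which is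
  -- at least the mean weight of C.
  cut-cycle-below-ratio : ∀ {i v R h x u} (P : DWalk E x u) (C : DWalk E u u) (Q : DWalk E u v) → IsCycle C →
    #t₂ (P ++ʷ (C ++ʷ Q)) ≡ i → #t₁ (P ++ʷ (C ++ʷ Q)) ≡ R → MaxT₁ i v R → h ≡ wt i R → i ℕ.+ R ≡ n →
    CycleBelow i v h
  cut-cycle-below-ratio {i} {v} {R} {h} P C Q cyc t r maxᵢ h≡ i+R≡n =
    _ , C , cyc , j , wt j Rⱼ , j<i , MaxT₁→IsH maxⱼ , C≤ratio
    where
    W′ : DWalk E _ v
    W′ = P ++ʷ Q
    j : ℕ
    j = #t₂ W′
    1≤aC : 1 ℕ.≤ #t₂ C
    1≤aC = closed-walk-has-t₂ C (proj₁ cyc)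
    i≡ : i ≡ j ℕ.+ #t₂ C
    i≡ = trans (sym t) (cut-cycle #t₂ #t₂-++ P C Q)
    R≡ : R ≡ #t₁ W′ ℕ.+ #t₁ C
    R≡ = trans (sym r) (cut-cycle #t₁ #t₁-++ P C Q)
    j<i : j ℕ.< i
    j<i = subst (j ℕ.<_) (sym i≡) (ℕP.m<m+n j 1≤aC)
    Rⱼ : ℕ
    Rⱼ = proj₁ (maxT₁-exists W′ refl)
    maxⱼ : MaxT₁ j v Rⱼ
    maxⱼ = proj₂ (maxT₁-exists W′ refl)
    Rⱼ≤R : Rⱼ ℕ.≤ R
    Rⱼ≤R = maxT₁-mono maxⱼ maxᵢ (ℕP.<⇒≤ j<i)
    b′ : ℕ
    b′ = proj₁ (ℕP.m≤n⇒∃[o]m+o≡n Rⱼ≤R)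
    R≡Rⱼ+b′ : R ≡ Rⱼ ℕ.+ b′
    R≡Rⱼ+b′ = sym (proj₂ (ℕP.m≤n⇒∃[o]m+o≡n Rⱼ≤R))
    b′≤bC : b′ ℕ.≤ #t₁ C
    b′≤bC = ℕP.+-cancelˡ-≤ Rⱼ b′ (#t₁ C) (subst (ℕ._≤ Rⱼ ℕ.+ #t₁ C) (trans (sym R≡) R≡Rⱼ+b′)
              (ℕP.+-monoˡ-≤ (#t₁ C) (proj₂ maxⱼ _ W′ refl)))
    mean≤ : mean (#t₂ C) (#t₁ C) ≤ mean (#t₂ C) b′
    mean≤ = from (mean-≤⇔ t₁>0 t₂>0 (#t₂ C) (#t₁ C) (#t₂ C) b′ (0<a+b (#t₁ C) 1≤aC) (0<a+b b′ 1≤aC))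
                 (ℕP.*-monoʳ-≤ (#t₂ C) b′≤bC)
    ratio≡ : ratio n h j (wt j Rⱼ) ≡ mean (#t₂ C) b′
    ratio≡ = trans (cong (λ h′ → ratio n h′ j (wt j Rⱼ)) h≡) (ratio≡mean i R j Rⱼ (#t₂ C) b′ i≡ R≡Rⱼ+b′ i+R≡n)
    C≤ratio : meanWeight t₁ t₂ C ≤ ratio n h j (wt j Rⱼ)
    C≤ratio = subst₂ _≤_ (sym (meanWeight≡mean C)) (sym ratio≡) mean≤

  -- If l(i,v) = n then an optimal walk for H(i,v) has n edges, so it is not a path and a
  -- cycle can be cut out of it.
  cycle-below-ratio : ∀ {i v h} → IsH E t₁ t₂ i v h → lval t₁ t₂ i h ≡ ℕ→ℚ n → CycleBelow i v h
  cycle-below-ratio {i} {v} {h} isH l≡n =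
    let (R , maxᵢ , h≡) = IsH→MaxT₁ isH
        ((x , W , t , r) , _) = maxᵢ
        i+R≡n = lval≡n i R (subst (λ h′ → lval t₁ t₂ i h′ ≡ ℕ→ℚ n) h≡ l≡n)
    in cut W t r maxᵢ h≡ i+R≡n (path-or-cycle W)
    where
    cut : ∀ {x R} (W : DWalk E x v) → #t₂ W ≡ i → #t₁ W ≡ R → MaxT₁ i v R → h ≡ wt i R → i ℕ.+ R ≡ n →
          Unique (vertices W) ⊎ CycleIn W → CycleBelow i v h
    cut W t r maxᵢ h≡ i+R≡n (inj₁ isPath) =
      ⊥-elim (ℕP.<-irrefl (trans (len-split W) (trans (cong₂ ℕ._+_ t r) i+R≡n)) (path-len< W isPath))
    cut _ t r maxᵢ h≡ i+R≡n (inj₂ (u , P , C , Q , refl , cyc)) = cut-cycle-below-ratio P C Q cyc t r maxᵢ h≡ i+R≡n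

  -- Let Cs be a closed walk of positive length
  -- whose profile (As , Bs) has mean weight at most that of every cycle.  Reweight walks by
  -- φ(w) = #t₂ w · Bs − #t₁ w · As, i.e. by the profile weight with t₁ := As, t₂ := Bs; up to
  -- a positive factor φ(w) is weight(w) − μ·len(w) for μ the mean weight of Cs.
  module Karp {u₀ : Fin n} (Cs : DWalk E u₀ u₀) (1≤len : 1 ℕ.≤ len Cs)
              (least : ∀ x (C : DWalk E x x) → IsCycle C → #t₂ Cs ℕ.* #t₁ C ℕ.≤ #t₂ C ℕ.* #t₁ Cs) where

    As Bs : ℕ
    As = #t₂ Cs
    Bs = #t₁ Cs

    As>0 : 0ℚ ℚ.< ℕ→ℚ As
    As>0 = ℕ→ℚ-mono-< (closed-walk-has-t₂ Cs 1≤len)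

    module Φ = ProfileWeight (ℕ→ℚ As) (ℕ→ℚ Bs)

    φ : ∀ {x y} → DWalk E x y → ℚ
    φ w = Φ.wt (#t₂ w) (#t₁ w)

    φ-++ : ∀ {x y z} (p : DWalk E x y) (q : DWalk E y z) → φ (p ++ʷ q) ≡ φ p + φ q
    φ-++ p q = trans (cong₂ Φ.wt (#t₂-++ p q) (#t₁-++ p q)) (Φ.wt-+ (#t₂ p) (#t₁ p) (#t₂ q) (#t₁ q))

    φ-repeat-Cs : ∀ m → φ (repeat m Cs) ≡ 0ℚ
    φ-repeat-Cs zero    = Φ.wt-zero
    φ-repeat-Cs (suc m) = begin
      φ (Cs ++ʷ repeat m Cs)       ≡⟨ φ-++ Cs (repeat m Cs) ⟩
      φ Cs + φ (repeat m Cs)       ≡⟨ cong₂ _+_ φ-Cs (φ-repeat-Cs m) ⟩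
      0ℚ + 0ℚ                      ≡⟨ ℚP.+-identityʳ 0ℚ ⟩
      0ℚ                           ∎
      where
      open ≡-Reasoning
      φ-Cs : φ Cs ≡ 0ℚ
      φ-Cs = solve 2 (λ A B → A :* B :- B :* A := con 0ℚ) refl (ℕ→ℚ As) (ℕ→ℚ Bs)

    φ-cycle-nonNeg : ∀ {x} (C : DWalk E x x) → IsCycle C → 0ℚ ≤ φ C
    φ-cycle-nonNeg C cyc = from (Φ.0≤wt⇔ (#t₂ C) (#t₁ C))
      (from (ℕ→ℚ-*-≤⇔ (#t₁ C) As (#t₂ C) Bs) (subst (ℕ._≤ #t₂ C ℕ.* Bs) (ℕP.*-comm As (#t₁ C)) (least _ C cyc)))

    -- Cutting a cycle out of a walk does not increase φ, so every walk ending at v can be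
    -- replaced by a path ending at v with no larger φ.
    φ-path-below : ∀ {x v} (w : DWalk E x v) →
                   Σ (Fin n) λ x′ → Σ (DWalk E x′ v) λ w′ → Unique (vertices w′) × (φ w′ ≤ φ w)
    φ-path-below = cycle-induction Below (λ {x} w isPath → x , w , isPath , ℚP.≤-refl) cut
      where
      Below : ∀ {x v} → DWalk E x v → Set
      Below {v = v} w = Σ (Fin n) λ x′ → Σ (DWalk E x′ v) λ w′ → Unique (vertices w′) × (φ w′ ≤ φ w)
      cut : ∀ {x u y} (P : DWalk E x u) (C : DWalk E u u) (Q : DWalk E u y) → IsCycle C →
            Below (P ++ʷ Q) → Below (P ++ʷ (C ++ʷ Q))
      cut P C Q cyc (x′ , w′ , isPath , le) = x′ , w′ , isPath , ℚP.≤-trans le (begin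
        φ (P ++ʷ Q)              ≡⟨ φ-++ P Q ⟩
        φ P + φ Q                ≡⟨ cong (φ P +_) (ℚP.+-identityˡ (φ Q)) ⟨
        φ P + (0ℚ + φ Q)         ≤⟨ ℚP.+-monoʳ-≤ (φ P) (ℚP.+-monoˡ-≤ (φ Q) (φ-cycle-nonNeg C cyc)) ⟩
        φ P + (φ C + φ Q)        ≡⟨ cong (φ P +_) (φ-++ C Q) ⟨
        φ P + φ (C ++ʷ Q)        ≡⟨ φ-++ P (C ++ʷ Q) ⟨
        φ (P ++ʷ (C ++ʷ Q))      ∎)
        where open ℚP.≤-Reasoning

    φ-profile : ℕ × ℕ → ℚ
    φ-profile (k , a) = Φ.wt a (k ℕ.∸ a)

    φ≡φ-profile : ∀ {x y} (w : DWalk E x y) → φ w ≡ φ-profile (len w , #t₂ w)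
    φ≡φ-profile w = cong (Φ.wt (#t₂ w)) (sym (trans (cong (ℕ._∸ #t₂ w) (len-split w)) (ℕP.m+n∸m≡n (#t₂ w) (#t₁ w))))

    -- Hence φ attains a minimum over the walks ending at any vertex v: it suffices to
    -- minimise over the finitely many profiles of paths.
    φ-minimum : ∀ v → Σ (Fin n) λ x → Σ (DWalk E x v) λ π → ∀ x′ (w : DWalk E x′ v) → φ π ≤ φ w
    φ-minimum v = from-minimum (minimum-below (ArrivesWith v) (arrivesWith? v) φ-profile n n 0<n 0<n (v , [] , refl , refl))
      where
      0<n : 0 ℕ.< n
      0<n = ℕ.>-nonZero⁻¹ n {{FinP.nonZeroIndex v}}
      from-minimum : Σ (ℕ × ℕ) (λ c → ArrivesWith v c ×
                (∀ k a → k ℕ.< n → a ℕ.< n → ArrivesWith v (k , a) → φ-profile c ≤ φ-profile (k , a))) →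
              Σ (Fin n) λ x → Σ (DWalk E x v) λ π → ∀ x′ (w : DWalk E x′ v) → φ π ≤ φ w
      from-minimum (c , (x , π , l , t) , min) = x , π , π-least
        where
        π-least : ∀ x′ (w : DWalk E x′ v) → φ π ≤ φ w
        π-least x′ w =
          let (x″ , w′ , isPath , w′≤w) = φ-path-below w
              len< = path-len< w′ isPath
          in begin
            φ π                           ≡⟨ φ≡φ-profile π ⟩
            φ-profile (len π , #t₂ π)     ≡⟨ cong₂ (λ k a → φ-profile (k , a)) l t ⟩
            φ-profile c                   ≤⟨ min (len w′) (#t₂ w′) len< (ℕP.≤-<-trans (#t₂≤len w′) len<) (x″ , w′ , refl , refl) ⟩
            φ-profile (len w′ , #t₂ w′)   ≡⟨ φ≡φ-profile w′ ⟨
            φ w′                          ≤⟨ w′≤w ⟩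
            φ w                           ∎
          where open ℚP.≤-Reasoning

    Witness : Set
    Witness = Σ ℕ λ i → Σ (Fin n) λ v → Σ ℚ λ h → IsH E t₁ t₂ i v h × (lval t₁ t₂ i h ≡ ℕ→ℚ n) ×
              (∀ j hⱼ → j ℕ.< i → IsH E t₁ t₂ j v hⱼ → ratio n h j hⱼ ≤ mean As Bs)

    -- Let π be φ-minimal at u₀ and A the prefix of length n of π ++ Cs ++ Cs ++ ⋯.  Then A is
    -- φ-minimal at its end v (a better walk to v, continued like π ++ Cs ++ ⋯, would beat π),
    -- so A realises H(#t₂ A , v) with l = n, and comparing φ(A) with the optimal walks for
    -- smaller indices bounds the quotients.
    module Prefix {xπ v : Fin n} (π : DWalk E xπ u₀) (π-least : ∀ x (w : DWalk E x u₀) → φ π ≤ φ w)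
                  (A : DWalk E xπ v) (B : DWalk E v u₀) (split : π ++ʷ repeat n Cs ≡ A ++ʷ B)
                  (lenA : len A ≡ n) where

      A-least : ∀ x (w : DWalk E x v) → φ A ≤ φ w
      A-least x w = +-cancelʳ-≤ (φ A) (φ w) (φ B) (begin
        φ A + φ B                    ≡⟨ φ-++ A B ⟨
        φ (A ++ʷ B)                  ≡⟨ cong φ split ⟨
        φ (π ++ʷ repeat n Cs)        ≡⟨ φ-++ π (repeat n Cs) ⟩
        φ π + φ (repeat n Cs)        ≡⟨ cong (φ π +_) (φ-repeat-Cs n) ⟩
        φ π + 0ℚ                     ≡⟨ ℚP.+-identityʳ (φ π) ⟩
        φ π                          ≤⟨ π-least x (w ++ʷ B) ⟩
        φ (w ++ʷ B)                  ≡⟨ φ-++ w B ⟩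
        φ w + φ B                    ∎)
        where open ℚP.≤-Reasoning

      i R : ℕ
      i = #t₂ A
      R = #t₁ A

      maxA : MaxT₁ i v R
      maxA = (_ , A , refl , refl) , λ x w t →
        to (Φ.wt-antitone As>0 i R (#t₁ w)) (subst (λ a → Φ.wt i R ≤ Φ.wt a (#t₁ w)) t (A-least x w))

      i+R≡n : i ℕ.+ R ≡ n
      i+R≡n = trans (sym (len-split A)) lenA

      -- For an optimal walk Wⱼ with j < i t₂-edges: φ(A) ≤ φ(Wⱼ) says that the difference
      -- profile (a , b) of A and Wⱼ satisfies a·Bs ≤ b·As, i.e. mean a b ≤ mean As Bs.
      optimal-quotient-bound : ∀ j Rⱼ → j ℕ.< i → MaxT₁ j v Rⱼ → ratio n (wt i R) j (wt j Rⱼ) ≤ mean As Bs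
      optimal-quotient-bound j Rⱼ j<i maxⱼ@((xⱼ , Wⱼ , tⱼ , rⱼ) , _) =
        subst (_≤ mean As Bs) (sym (ratio≡mean i R j Rⱼ a b i≡ R≡ i+R≡n)) mean-a-b≤
        where
        a b : ℕ
        a = proj₁ (ℕP.m≤n⇒∃[o]m+o≡n (ℕP.<⇒≤ j<i))
        b = proj₁ (ℕP.m≤n⇒∃[o]m+o≡n (maxT₁-mono maxⱼ maxA (ℕP.<⇒≤ j<i)))
        i≡ : i ≡ j ℕ.+ a
        i≡ = sym (proj₂ (ℕP.m≤n⇒∃[o]m+o≡n (ℕP.<⇒≤ j<i)))
        R≡ : R ≡ Rⱼ ℕ.+ b
        R≡ = sym (proj₂ (ℕP.m≤n⇒∃[o]m+o≡n (maxT₁-mono maxⱼ maxA (ℕP.<⇒≤ j<i))))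
        1≤a : 1 ℕ.≤ a
        1≤a = ℕP.+-cancelˡ-≤ j 1 a (subst (j ℕ.+ 1 ℕ.≤_) i≡ (subst (ℕ._≤ i) (ℕP.+-comm 1 j) j<i))
        A≤Wⱼ : Φ.wt (j ℕ.+ a) (Rⱼ ℕ.+ b) ≤ Φ.wt j Rⱼ
        A≤Wⱼ = subst₂ (λ p q → Φ.wt p q ≤ Φ.wt j Rⱼ) i≡ R≡ (subst₂ (λ p q → Φ.wt i R ≤ Φ.wt p q) tⱼ rⱼ (A-least xⱼ Wⱼ))
        aBs≤bAs : a ℕ.* Bs ℕ.≤ b ℕ.* As
        aBs≤bAs = to (ℕ→ℚ-*-≤⇔ a Bs b As) (to (Φ.wt-extend-≤⇔ j Rⱼ a b) A≤Wⱼ)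
        mean-a-b≤ : mean a b ≤ mean As Bs
        mean-a-b≤ = from (mean-≤⇔ t₁>0 t₂>0 a b As Bs (0<a+b b 1≤a) (0<a+b Bs (closed-walk-has-t₂ Cs 1≤len)))
                         (subst (a ℕ.* Bs ℕ.≤_) (ℕP.*-comm b As) aBs≤bAs)

      quotient-bound : ∀ j hⱼ → j ℕ.< i → IsH E t₁ t₂ j v hⱼ → ratio n (wt i R) j hⱼ ≤ mean As Bs
      quotient-bound j hⱼ j<i isHⱼ =
        let (Rⱼ , maxⱼ , hⱼ≡) = IsH→MaxT₁ isHⱼ
        in subst (λ h′ → ratio n (wt i R) j h′ ≤ mean As Bs) (sym hⱼ≡) (optimal-quotient-bound j Rⱼ j<i maxⱼ)

      witness : Witness
      witness = i , v , wt i R , MaxT₁→IsH maxA , trans (lval-wt t₁>0 i R) (cong ℕ→ℚ i+R≡n) , quotient-bound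

    long-enough : ∀ {x} (π : DWalk E x u₀) → n ℕ.≤ len (π ++ʷ repeat n Cs)
    long-enough π = subst (n ℕ.≤_) (sym (len-++ π (repeat n Cs)))
                      (ℕP.≤-trans (len-repeat n Cs 1≤len) (ℕP.m≤n+m _ (len π)))

    witness : Witness
    witness =
      let (xπ , π , π-least) = φ-minimum u₀
          (v , A , B , split , lenA) = split-at-len n (π ++ʷ repeat n Cs) (long-enough π)
      in Prefix.witness π π-least A B split lenA

  cycle-below-max : ∀ {i v h m} → IsH E t₁ t₂ i v h → lval t₁ t₂ i h ≡ ℕ→ℚ n → IsMaxRatio E t₁ t₂ i v h m →
                    Σ (Fin n) λ x → Σ (DWalk E x x) λ C → IsCycle C × (meanWeight t₁ t₂ C ≤ m)
  cycle-below-max isH l≡n (_ , max) =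
    let (x , C , cyc , j , hⱼ , j<i , isHⱼ , C≤) = cycle-below-ratio isH l≡n
    in x , C , cyc , ℚP.≤-trans C≤ (max j hⱼ j<i isHⱼ)

  below-every-max : ∀ {μ} → (∀ x (C : DWalk E x x) → IsCycle C → μ ≤ meanWeight t₁ t₂ C) →
                    ∀ i v h m → IsH E t₁ t₂ i v h → lval t₁ t₂ i h ≡ ℕ→ℚ n → IsMaxRatio E t₁ t₂ i v h m → μ ≤ m
  below-every-max μ-least i v h m isH l≡n isMax =
    let (x , C , cyc , C≤m) = cycle-below-max isH l≡n isMax in ℚP.≤-trans (μ-least x C cyc) C≤m

  -- Attainment: if the closed walk Cs has mean weight at most that of every cycle, then
  -- the mean weight of Cs is the maximal quotient at some admissible (i,v): Karp's bound
  -- shows it is an upper bound, and the cycle below a quotient shows it is attained.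
  karp : ∀ {u₀} (Cs : DWalk E u₀ u₀) → 1 ℕ.≤ len Cs →
         (∀ x (C : DWalk E x x) → IsCycle C → meanWeight t₁ t₂ Cs ≤ meanWeight t₁ t₂ C) →
         Σ ℕ λ i → Σ (Fin n) λ v → Σ ℚ λ h → IsH E t₁ t₂ i v h × (lval t₁ t₂ i h ≡ ℕ→ℚ n)
           × IsMaxRatio E t₁ t₂ i v h (meanWeight t₁ t₂ Cs)
  karp Cs 1≤len Cs-least =
    let (i , v , h , isH , l≡n , bound) = Karp.witness Cs 1≤len cross-least
        (x , C , cyc , j , hⱼ , j<i , isHⱼ , C≤) = cycle-below-ratio isH l≡n
        bound′ : ∀ j hⱼ → j ℕ.< i → IsH E t₁ t₂ j v hⱼ → ratio n h j hⱼ ≤ meanWeight t₁ t₂ Cs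
        bound′ j hⱼ j<i isHⱼ = subst (ratio n h j hⱼ ≤_) (sym (meanWeight≡mean Cs)) (bound j hⱼ j<i isHⱼ)
    in i , v , h , isH , l≡n ,
       (j , hⱼ , j<i , isHⱼ , ℚP.≤-antisym (bound′ j hⱼ j<i isHⱼ) (ℚP.≤-trans (Cs-least x C cyc) C≤)) , bound′
    where
    cross-least : ∀ x (C : DWalk E x x) → IsCycle C → #t₂ Cs ℕ.* #t₁ C ℕ.≤ #t₂ C ℕ.* #t₁ Cs
    cross-least x C cyc =
      to (mean-≤⇔ t₁>0 t₂>0 (#t₂ Cs) (#t₁ Cs) (#t₂ C) (#t₁ C) (0<a+b (#t₁ Cs) (closed-walk-has-t₂ Cs 1≤len))
                  (0<a+b (#t₁ C) (closed-walk-has-t₂ C (proj₁ cyc))))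
         (subst₂ _≤_ (meanWeight≡mean Cs) (meanWeight≡mean C) (Cs-least x C cyc))

  mean-profile : ℕ × ℕ → ℚ
  mean-profile (k , a) = mean a (k ℕ.∸ a)

  meanWeight≡mean-profile : ∀ {x y} (w : DWalk E x y) → meanWeight t₁ t₂ w ≡ mean-profile (len w , #t₂ w)
  meanWeight≡mean-profile w = trans (meanWeight≡mean w)
    (cong (mean (#t₂ w)) (sym (trans (cong (ℕ._∸ #t₂ w) (len-split w)) (ℕP.m+n∸m≡n (#t₂ w) (#t₁ w)))))

  cycle-profile< : ∀ {x} (C : DWalk E x x) → IsCycle C → (len C ℕ.< suc n) × (#t₂ C ℕ.< suc n)
  cycle-profile< C cyc = s≤s (cycle-len≤ C cyc) , s≤s (ℕP.≤-trans (#t₂≤len C) (cycle-len≤ C cyc))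

  -- If G_d has a cycle then some closed walk of positive length has mean weight at most
  -- that of every cycle: minimise over the finitely many profiles of closed walks with at
  -- most n edges.
  least-mean-closed-walk : ∀ {x₁} (C₁ : DWalk E x₁ x₁) → IsCycle C₁ →
    Σ (Fin n) λ u₀ → Σ (DWalk E u₀ u₀) λ Cs → (1 ℕ.≤ len Cs) ×
      (∀ x (C : DWalk E x x) → IsCycle C → meanWeight t₁ t₂ Cs ≤ meanWeight t₁ t₂ C)
  least-mean-closed-walk C₁ cyc₁ =
    from-minimum (minimum-below ClosedWith closedWith? mean-profile (suc n) (suc n)
                    (proj₁ (cycle-profile< C₁ cyc₁)) (proj₂ (cycle-profile< C₁ cyc₁)) (proj₁ cyc₁ , _ , C₁ , refl , refl))
    where
    from-minimum : Σ (ℕ × ℕ) (λ c → ClosedWith c × (∀ k a → k ℕ.< suc n → a ℕ.< suc n →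
                       ClosedWith (k , a) → mean-profile c ≤ mean-profile (k , a))) →
                   Σ (Fin n) λ u₀ → Σ (DWalk E u₀ u₀) λ Cs → (1 ℕ.≤ len Cs) ×
                     (∀ x (C : DWalk E x x) → IsCycle C → meanWeight t₁ t₂ Cs ≤ meanWeight t₁ t₂ C)
    from-minimum (c , (1≤k , u₀ , Cs , l , t) , min) = u₀ , Cs , subst (1 ℕ.≤_) (sym l) 1≤k , Cs-least
      where
      Cs-least : ∀ x (C : DWalk E x x) → IsCycle C → meanWeight t₁ t₂ Cs ≤ meanWeight t₁ t₂ C
      Cs-least x C cyc = begin
        meanWeight t₁ t₂ Cs           ≡⟨ meanWeight≡mean-profile Cs ⟩
        mean-profile (len Cs , #t₂ Cs) ≡⟨ cong₂ (λ k a → mean-profile (k , a)) l t ⟩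
        mean-profile c                ≤⟨ min (len C) (#t₂ C) (proj₁ (cycle-profile< C cyc)) (proj₂ (cycle-profile< C cyc))
                                             (proj₁ cyc , x , C , refl , refl) ⟩
        mean-profile (len C , #t₂ C)  ≡⟨ meanWeight≡mean-profile C ⟨
        meanWeight t₁ t₂ C            ∎
        where open ℚP.≤-Reasoning

open import Data.Rational using (_<_)

theorem16 : ∀ {n : ℕ} (E : Fin n → Fin n → Bool) → IsDag E
    → (t₁ t₂ : ℚ) → 0ℚ < t₁ → 0ℚ < t₂
    → (μ : ℚ) → (IsMinMeanCycleWeight E t₁ t₂ μ ⇔ IsMinMaxRatio E t₁ t₂ μ)
theorem16 E dag t₁ t₂ t₁>0 t₂>0 μ = mk⇔ to′ from′
  where
  open MinMeanCycle E dag t₁ t₂ t₁>0 t₂>0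
  open import Data.Rational using (_≤_)
  open import Data.Product using (proj₁)

  -- A least-mean cycle C₀ is attained as a maximal quotient (karp), and every maximal
  -- quotient is at least the mean of some cycle.
  to′ : IsMinMeanCycleWeight E t₁ t₂ μ → IsMinMaxRatio E t₁ t₂ μ
  to′ ((x₀ , C₀ , cyc₀ , C₀≡μ) , μ-least) =
    let (i , v , h , isH , l≡n , isMax) = karp C₀ (proj₁ cyc₀) (λ x C cyc → subst (_≤ meanWeight t₁ t₂ C) (sym C₀≡μ) (μ-least x C cyc))
    in (i , v , h , isH , l≡n , subst (IsMaxRatio E t₁ t₂ i v h) C₀≡μ isMax) , below-every-max μ-least

  -- The min-max μ bounds a cycle C₁ from above (cycle-below-max) and, through a
  -- least-mean closed walk Cs, every cycle from below.
  from′ : IsMinMaxRatio E t₁ t₂ μ → IsMinMeanCycleWeight E t₁ t₂ μ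
  from′ ((i₀ , v₀ , h₀ , isH₀ , l₀≡n , isMax₀) , μ-least) =
    let (x₁ , C₁ , cyc₁ , C₁≤μ) = cycle-below-max isH₀ l₀≡n isMax₀
        (u₀ , Cs , 1≤len , Cs-least) = least-mean-closed-walk C₁ cyc₁
        (i , v , h , isH , l≡n , isMax) = karp Cs 1≤len Cs-least
        μ≤cycles : ∀ x (C : DWalk E x x) → IsCycle C → μ ≤ meanWeight t₁ t₂ C
        μ≤cycles x C cyc = ℚP.≤-trans (μ-least i v h (meanWeight t₁ t₂ Cs) isH l≡n isMax) (Cs-least x C cyc)
    in (x₁ , C₁ , cyc₁ , ℚP.≤-antisym C₁≤μ (μ≤cycles x₁ C₁ cyc₁)) , μ≤cycles
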